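{- Let $j^{(\operatorname{lrmin},\operatorname{asc})}_{n,i,k}(123)$ be the number of $123$-avoiding Jacobi permutations $\pi\in\mathfrak{S}_n$ with $\operatorname{lrmin}(\pi)=i$ and $\operatorname{asc}(\pi)=k$. For all $n,i,k$ with $n\geq i\geq k\geq0$ and $k\leq(n-i)/2$, \[ j^{(\operatorname{lrmin},\operatorname{asc})}_{n,i,k}(123)=\frac{1}{n+1}\binom{n+1}{k}\binom{n+1-k}{i-k}\binom{\frac{n-i}{2}-1}{k-1} \] if $n$ and $i$ have the same parity, and $j^{(\operatorname{lrmin},\operatorname{asc})}_{n,i,k}(123)=0$ otherwise.
   Context: A permutation of a finite set $S$ of positive integers is a word in which each element of $S$ appears exactly once; $\mathfrak{S}_n$ is the set of permutations of $\{1,\dots,n\}$ ($\mathfrak{S}_0$ contains only the empty permutation). For a permutation $\pi$ and a letter $x$ of $\pi$, $\rho_\pi(x)$ is the maximal consecutive subword of $\pi$ consisting of the letters immediately to the right of $x$ that are all larger than $x$. $\pi$ is Jacobi if $|\rho_\pi(x)|$ is even for all letters $x$. A permutation $\pi$ avoids a pattern $\sigma$ if no subword of $\pi$ has standardization (relative order) $\sigma$. A letter $\pi_j$ is a left-to-right minimum if $\pi_j<\pi_l$ for all $l<j$; $\operatorname{lrmin}(\pi)$ counts them. An ascent of $\pi\in\mathfrak{S}_n$ is an index $j\in[n-1]$ with $\pi_j<\pi_{j+1}$; $\operatorname{asc}(\pi)$ counts them. Binomial coefficients are read with the convention $\binom{ -1}{ -1}=1$ and $\binom{a}{b}=0$ whenever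 $b<0$ and $(a,b)\neq(-1,-1)$, or $b>a\geq0$. -}

module Defs where

open import Data.Nat using (ℕ; zero; suc; _+_; _*_; _∸_; _<_; _<?_; _≤_)
open import Data.Nat.Combinatorics using (_C_)
open import Data.Nat.Divisibility using (_∣_)
open import Data.Integer using (ℤ; +_; -[1+_])
open import Data.List using (List; []; _∷_; length; map; upTo; takeWhile)
open import Data.List.Relation.Unary.All using (All; all?)
open import Data.List.Relation.Unary.Unique.Propositional using (Unique)
open import Data.List.Membership.Propositional using (_∈_)
open import Data.List.Relation.Binary.Permutation.Propositional using (_↭_)
open import Data.List.Relation.Binary.Sublist.Propositional using (_⊆_)
open import Data.Product using (Σ; _×_)
open import Data.Unit using (⊤)
open import Relation.Nullary using (¬_; does)
open import Relation.Binary.PropositionalEquality using (_≡_)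
open import Data.Bool using (if_then_else_)

oneTo : ℕ → List ℕ
oneTo n = map suc (upTo n)

IsPerm : ℕ → List ℕ → Set
IsPerm n π = π ↭ oneTo n

-- |ρ_π(x)| for the letter x followed (in π) by the word xs
rhoLen : ℕ → List ℕ → ℕ
rhoLen x xs = length (takeWhile (x <?_) xs)

Jacobi : List ℕ → Set
Jacobi []       = ⊤
Jacobi (x ∷ xs) = 2 ∣ rhoLen x xs × Jacobi xs

Avoids123 : List ℕ → Set
Avoids123 π = ∀ a b c → (a ∷ b ∷ c ∷ []) ⊆ π → ¬ (a < b × b < c)

lrminAux : List ℕ → List ℕ → ℕ
lrminAux pre []       = 0
lrminAux pre (x ∷ xs) =
  (if does (all? (x <?_) pre) then 1 else 0) + lrminAux (x ∷ pre) xs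

lrmin : List ℕ → ℕ
lrmin π = lrminAux [] π

asc : List ℕ → ℕ
asc []           = 0
asc (x ∷ [])     = 0
asc (x ∷ y ∷ xs) = (if does (x <? y) then 1 else 0) + asc (y ∷ xs)

HasCount : (List ℕ → Set) → ℕ → Set
HasCount P m =
  Σ (List (List ℕ)) λ L →
    Unique L × ((π : List ℕ) → (π ∈ L → P π) × (P π → π ∈ L)) × length L ≡ m

J : ℕ → ℕ → ℕ → List ℕ → Set
J n i k π = IsPerm n π × Avoids123 π × Jacobi π × lrmin π ≡ i × asc π ≡ k

-- binomial coefficient with integer arguments, paper's convention:
-- C(-1,-1) = 1; C(a,b) = 0 if b < 0 otherwise; C(a,b) = 0 if b > a ≥ 0
-- (the usual one for a,b ≥ 0). The case a < 0 ≤ b is left unspecified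
-- by the paper and never arises in the theorem; it is set to 0 here.
binomℤ : ℤ → ℤ → ℕ
binomℤ -[1+ zero ] -[1+ zero ] = 1
binomℤ _           -[1+ _ ]    = 0
binomℤ (+ a)       (+ b)       = a C b
binomℤ -[1+ _ ]    (+ _)       = 0

pred' : ℕ → ℤ
pred' zero    = -[1+ 0 ]
pred' (suc a) = + a

-- A 123-avoiding permutation is the union of two decreasing subsequences, its left-to-right
-- minima and its other letters; it is Jacobi exactly when each left-to-right minimum is
-- followed by a run of larger letters of even length, and each nonempty run then carries
-- exactly one ascent. Such permutations arise from scanning the values n, n − 1, …, 1: each
-- value either becomes the next left-to-right minimum or is deferred, and deferred values are
-- written, largest first, into the run of the current minimum. The states of this scan can be
-- enumerated without repetition, and their numbers obey a linear recurrence. By induction on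
-- the number u of scanned values, u times the number of states ready for a new minimum, with
-- i minima, k ascents, t run letters and s − 1 deferred values, is the ballot-type product
-- s·C(u, i)·C(i, k)·E(t, k), where E(t, k) = C(t/2 − 1, k − 1) counts the splittings of t
-- into k positive even run lengths. For u = n + 1 and s = 1 this gives the stated formula.

module Submission where

open import Defs
open import Data.Nat using (ℕ; suc; _+_; _*_; _∸_; _≤_; _/_; _%_)
open import Data.Nat.Combinatorics using (_C_)
open import Relation.Binary.PropositionalEquality using (_≡_)
open import Relation.Nullary using (¬_)
open import Data.Product using (_×_)

open import Level using (Level)
open import Function using (case_of_)
open import Data.Empty using (⊥; ⊥-elim)
open import Data.Unit using (tt)
open import Data.Bool using (if_then_else_; true; false)
open import Data.Bool.Properties using (if-float)
open import Data.Product using (∃; ∃₂; _,_; proj₁; proj₂)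
open import Data.Sum using (_⊎_; inj₁; inj₂)
open import Data.Nat
open import Data.Nat.Properties
open import Data.Nat.DivMod using (m*n/n≡m; [m+kn]%n≡m%n)
open import Data.Nat.Divisibility using (_∣_; divides; _∣0)
open import Data.Nat.Combinatorics using (nC1≡n; nCk+nC[k+1]≡[n+1]C[k+1]; k>n⇒nCk≡0)
open import Data.Nat.Tactic.RingSolver using (solve-∀)
open import Data.List
  using (List; []; _∷_; _++_; [_]; length; takeWhile; map; upTo; applyUpTo; applyDownFrom; _ʳ++_; initLast; _∷ʳ′_)
open import Data.List.Properties
  using ( ++-assoc; ++-identityʳ; length-++; length-map; length-upTo; length-applyDownFrom
        ; ∷ʳ-injective; ∷ʳ-injectiveˡ; ∷ʳ-injectiveʳ; reverse-applyUpTo; map-upTo)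
open import Data.List.Membership.Propositional using (_∈_)
open import Data.List.Membership.Propositional.Properties using (∈-++⁺ˡ; ∈-++⁺ʳ; ∈-++⁻; ∈-map⁺; ∈-map⁻)
open import Data.List.Relation.Unary.All as All using (All; []; _∷_; all?)
import Data.List.Relation.Unary.All.Properties as Allₚ
open import Data.List.Relation.Unary.AllPairs as AllPairs using (AllPairs; []; _∷_)
import Data.List.Relation.Unary.AllPairs.Properties as AllPairsₚ
open import Data.List.Relation.Unary.Any using (here; there)
open import Data.List.Relation.Unary.Unique.Propositional using (Unique)
import Data.List.Relation.Unary.Unique.Propositional.Properties as Uniqueₚ
open import Data.List.Relation.Binary.Sublist.Propositional using (_⊆_; []; _∷_; _∷ʳ_; to∈; from∈)
open import Data.List.Relation.Binary.Sublist.Propositional.Properties using () renaming (++⁺ to ⊆-++⁺)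
open import Data.List.Relation.Binary.Permutation.Propositional using (_↭_; ↭-sym; ↭-trans; ↭⇒↭ₛ)
open import Data.List.Relation.Binary.Permutation.Propositional.Properties
  using (↭-reverse; shift; ++⁺ˡ; ↭-length; ∈-resp-↭)
open import Relation.Nullary using (yes; no; does)
open import Relation.Nullary.Decidable using (dec-true; dec-false)
open import Relation.Unary using (Pred; Decidable)
open import Relation.Binary.PropositionalEquality hiding ([_]; J)
open import Data.List.Relation.Binary.Permutation.Setoid.Properties (setoid ℕ) using (Unique-resp-↭)
open ≡-Reasoning

-- Binomial coefficients and even compositions

[1+n]*nCk≡[1+k]*[1+n]C[1+k] : ∀ n k → suc n * (n C k) ≡ suc k * (suc n C suc k)
[1+n]*nCk≡[1+k]*[1+n]C[1+k] zero    zero    = refl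
[1+n]*nCk≡[1+k]*[1+n]C[1+k] zero    (suc k) = sym (*-zeroʳ (suc (suc k)))
[1+n]*nCk≡[1+k]*[1+n]C[1+k] (suc n) zero    =
  trans (*-identityʳ (suc (suc n))) (sym (trans (+-identityʳ _) (nC1≡n (suc (suc n)))))
[1+n]*nCk≡[1+k]*[1+n]C[1+k] (suc n) (suc k) = begin
  suc (suc n) * (suc n C suc k)
    ≡⟨ cong (suc (suc n) *_) (nCk+nC[k+1]≡[n+1]C[k+1] n k) ⟨
  suc (suc n) * (n C k + n C suc k)
    ≡⟨ regroup n (n C k) (n C suc k) ⟩
  (suc n * (n C k) + (n C k + n C suc k)) + suc n * (n C suc k)
    ≡⟨ cong₂ (λ x y → (x + (n C k + n C suc k)) + y)
         ([1+n]*nCk≡[1+k]*[1+n]C[1+k] n k) ([1+n]*nCk≡[1+k]*[1+n]C[1+k] n (suc k)) ⟩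
  (suc k * (suc n C suc k) + (n C k + n C suc k)) + suc (suc k) * (suc n C suc (suc k))
    ≡⟨ cong (λ x → (suc k * (suc n C suc k) + x) + suc (suc k) * (suc n C suc (suc k)))
         (nCk+nC[k+1]≡[n+1]C[k+1] n k) ⟩
  (suc k * (suc n C suc k) + suc n C suc k) + suc (suc k) * (suc n C suc (suc k))
    ≡⟨ collect k (suc n C suc k) (suc n C suc (suc k)) ⟩
  suc (suc k) * (suc n C suc k + suc n C suc (suc k))
    ≡⟨ cong (suc (suc k) *_) (nCk+nC[k+1]≡[n+1]C[k+1] (suc n) (suc k)) ⟩
  suc (suc k) * (suc (suc n) C suc (suc k)) ∎
  where
  regroup : ∀ n a b → suc (suc n) * (a + b) ≡ (suc n * a + (a + b)) + suc n * b
  regroup = solve-∀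
  collect : ∀ k x y → (suc k * x + x) + suc (suc k) * y ≡ suc (suc k) * (x + y)
  collect = solve-∀

[1+n]*nCk≡[1+n∸k]*[1+n]Ck : ∀ n k → suc n * (n C k) ≡ (suc n ∸ k) * (suc n C k)
[1+n]*nCk≡[1+n∸k]*[1+n]Ck n zero    = refl
[1+n]*nCk≡[1+n∸k]*[1+n]Ck n (suc k) = begin
  suc n * (n C suc k)
    ≡⟨ m+n∸m≡n (suc n * (n C k)) (suc n * (n C suc k)) ⟨
  (suc n * (n C k) + suc n * (n C suc k)) ∸ suc n * (n C k)
    ≡⟨ cong₂ _∸_ (sym (*-distribˡ-+ (suc n) (n C k) (n C suc k))) ([1+n]*nCk≡[1+k]*[1+n]C[1+k] n k) ⟩
  suc n * (n C k + n C suc k) ∸ suc k * (suc n C suc k)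
    ≡⟨ cong (λ x → suc n * x ∸ suc k * (suc n C suc k)) (nCk+nC[k+1]≡[n+1]C[k+1] n k) ⟩
  suc n * (suc n C suc k) ∸ suc k * (suc n C suc k)
    ≡⟨ *-distribʳ-∸ (suc n C suc k) (suc n) (suc k) ⟨
  (suc n ∸ suc k) * (suc n C suc k) ∎

[a+b]Ca*[a!*b!]≡[a+b]! : ∀ a b → ((a + b) C a) * (a ! * b !) ≡ (a + b) !
[a+b]Ca*[a!*b!]≡[a+b]! zero    b = begin
  1 * (1 * b !) ≡⟨ *-identityˡ (1 * b !) ⟩
  1 * b !       ≡⟨ *-identityˡ (b !) ⟩
  b !           ∎
[a+b]Ca*[a!*b!]≡[a+b]! (suc a) b = begin
  (suc (a + b) C suc a) * ((suc a * a !) * b !)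
    ≡⟨ shuffle (suc (a + b) C suc a) a (a !) (b !) ⟩
  (suc a * (suc (a + b) C suc a)) * (a ! * b !)
    ≡⟨ cong (_* (a ! * b !)) ([1+n]*nCk≡[1+k]*[1+n]C[1+k] (a + b) a) ⟨
  (suc (a + b) * ((a + b) C a)) * (a ! * b !)
    ≡⟨ *-assoc (suc (a + b)) ((a + b) C a) (a ! * b !) ⟩
  suc (a + b) * (((a + b) C a) * (a ! * b !))
    ≡⟨ cong (suc (a + b) *_) ([a+b]Ca*[a!*b!]≡[a+b]! a b) ⟩
  suc (a + b) * (a + b) ! ∎
  where
  shuffle : ∀ x a f g → x * ((suc a * f) * g) ≡ (suc a * x) * (f * g)
  shuffle = solve-∀

[a+b+c]Ca*[b+c]Cb≡[a+b+c]C[a+b]*[a+b]Ca : ∀ a b c →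
  ((a + b + c) C a) * ((b + c) C b) ≡ ((a + b + c) C (a + b)) * ((a + b) C a)
[a+b+c]Ca*[b+c]Cb≡[a+b+c]C[a+b]*[a+b]Ca a b c =
  *-cancelʳ-≡ _ _ (a ! * (b ! * c !)) {{a!*[b!*c!]≢0}} (begin
    x * y * (a ! * (b ! * c !))
      ≡⟨ shuffle₁ x y (a !) (b !) (c !) ⟩
    x * (a ! * (y * (b ! * c !)))
      ≡⟨ cong (λ z → x * (a ! * z)) ([a+b]Ca*[a!*b!]≡[a+b]! b c) ⟩
    x * (a ! * (b + c) !)
      ≡⟨ cong (λ z → (z C a) * (a ! * (b + c) !)) (+-assoc a b c) ⟩
    ((a + (b + c)) C a) * (a ! * (b + c) !)
      ≡⟨ [a+b]Ca*[a!*b!]≡[a+b]! a (b + c) ⟩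
    (a + (b + c)) !
      ≡⟨ cong _! (+-assoc a b c) ⟨
    (a + b + c) !
      ≡⟨ [a+b]Ca*[a!*b!]≡[a+b]! (a + b) c ⟨
    x′ * ((a + b) ! * c !)
      ≡⟨ cong (λ z → x′ * (z * c !)) ([a+b]Ca*[a!*b!]≡[a+b]! a b) ⟨
    x′ * ((y′ * (a ! * b !)) * c !)
      ≡⟨ shuffle₂ x′ y′ (a !) (b !) (c !) ⟩
    x′ * y′ * (a ! * (b ! * c !)) ∎)
  where
  x  = (a + b + c) C a
  y  = (b + c) C b
  x′ = (a + b + c) C (a + b)
  y′ = (a + b) C a
  a!*[b!*c!]≢0 = m*n≢0 (a !) (b ! * c !) {{a !≢0}} {{m*n≢0 (b !) (c !) {{b !≢0}} {{c !≢0}}}}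
  shuffle₁ : ∀ x y f g h → x * y * (f * (g * h)) ≡ x * (f * (y * (g * h)))
  shuffle₁ = solve-∀
  shuffle₂ : ∀ x y f g h → x * ((y * (f * g)) * h) ≡ x * y * (f * (g * h))
  shuffle₂ = solve-∀

odd∤ : ∀ m → ¬ 2 ∣ suc (2 * m)
odd∤ m (divides q eq) = even≢odd q m (trans (*-comm 2 q) (sym eq))

data EvenOdd : ℕ → Set where
  even : ∀ m → EvenOdd (m * 2)
  odd  : ∀ m → EvenOdd (suc (m * 2))

evenOdd : ∀ t → EvenOdd t
evenOdd zero          = even 0
evenOdd (suc zero)    = odd 0
evenOdd (suc (suc t)) with evenOdd t
... | even m = even (suc m)
... | odd m  = odd (suc m)

[1+m]%2≢m%2 : ∀ m → suc m % 2 ≢ m % 2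
[1+m]%2≢m%2 zero          ()
[1+m]%2≢m%2 (suc zero)    ()
[1+m]%2≢m%2 (suc (suc m)) = [1+m]%2≢m%2 m

n∸i-parity : ∀ {n i} → i ≤ n →
  (∃ λ m → n ∸ i ≡ m * 2 × n % 2 ≡ i % 2) ⊎ (∃ λ m → n ∸ i ≡ suc (m * 2) × n % 2 ≢ i % 2)
n∸i-parity {n} {i} i≤n with n ∸ i | m+[n∸m]≡n i≤n | evenOdd (n ∸ i)
... | _ | i+t≡n | even m = inj₁ (m , refl , trans (cong (_% 2) (sym i+t≡n)) ([m+kn]%n≡m%n i m 2))
... | _ | i+t≡n | odd m  = inj₂ (m , refl , λ n≡i → [1+m]%2≢m%2 i
  (trans (sym ([m+kn]%n≡m%n (suc i) m 2)) (trans (cong (_% 2) (trans (sym (+-suc i (m * 2))) i+t≡n)) n≡i)))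

-- Compositions of t into k positive even parts, split on whether the last part is 2.
evenCompositions : ℕ → ℕ → ℕ
evenCompositions zero          zero    = 1
evenCompositions zero          (suc k) = 0
evenCompositions (suc zero)    k       = 0
evenCompositions (suc (suc t)) zero    = 0
evenCompositions (suc (suc t)) (suc k) = evenCompositions t k + evenCompositions t (suc k)

evenCompositions-odd : ∀ m k → evenCompositions (suc (m * 2)) k ≡ 0
evenCompositions-odd zero    k       = refl
evenCompositions-odd (suc m) zero    = refl
evenCompositions-odd (suc m) (suc k) =
  cong₂ _+_ (evenCompositions-odd m k) (evenCompositions-odd m (suc k))

evenCompositions-[1+m]*2 : ∀ m k → evenCompositions (suc m * 2) (suc k) ≡ m C k
evenCompositions-[1+m]*2 zero    zero    = refl
evenCompositions-[1+m]*2 zero    (suc k) = refl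
evenCompositions-[1+m]*2 (suc m) zero    = evenCompositions-[1+m]*2 m zero
evenCompositions-[1+m]*2 (suc m) (suc k) =
  trans (cong₂ _+_ (evenCompositions-[1+m]*2 m k) (evenCompositions-[1+m]*2 m (suc k)))
        (nCk+nC[k+1]≡[n+1]C[k+1] m k)

binomℤ-pred′≡evenCompositions : ∀ m k → binomℤ (pred' m) (pred' k) ≡ evenCompositions (m * 2) k
binomℤ-pred′≡evenCompositions zero    zero    = refl
binomℤ-pred′≡evenCompositions zero    (suc k) = refl
binomℤ-pred′≡evenCompositions (suc m) zero    = refl
binomℤ-pred′≡evenCompositions (suc m) (suc k) = sym (evenCompositions-[1+m]*2 m k)

t*evenCompositions[t,0]≡0 : ∀ t → t * evenCompositions t 0 ≡ 0
t*evenCompositions[t,0]≡0 zero          = refl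
t*evenCompositions[t,0]≡0 (suc zero)    = refl
t*evenCompositions[t,0]≡0 (suc (suc t)) = *-zeroʳ (suc (suc t))

2*[1+k]*evenCompositions[2+t,2+k]≡t*evenCompositions[t,1+k] : ∀ t k →
  2 * (suc k * evenCompositions (2 + t) (2 + k)) ≡ t * evenCompositions t (suc k)
2*[1+k]*evenCompositions[2+t,2+k]≡t*evenCompositions[t,1+k] t k with evenOdd t
... | even zero    = cong (2 *_) (*-zeroʳ (suc k))
... | even (suc m) = begin
  2 * (suc k * evenCompositions (suc (suc m) * 2) (suc (suc k)))
    ≡⟨ cong (λ x → 2 * (suc k * x)) (evenCompositions-[1+m]*2 (suc m) (suc k)) ⟩
  2 * (suc k * (suc m C suc k))
    ≡⟨ cong (2 *_) ([1+n]*nCk≡[1+k]*[1+n]C[1+k] m k) ⟨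
  2 * (suc m * (m C k))
    ≡⟨ reorder m (m C k) ⟩
  suc m * 2 * (m C k)
    ≡⟨ cong (suc m * 2 *_) (evenCompositions-[1+m]*2 m k) ⟨
  suc m * 2 * evenCompositions (suc m * 2) (suc k) ∎
  where
  reorder : ∀ m x → 2 * (suc m * x) ≡ suc m * 2 * x
  reorder = solve-∀
... | odd m = begin
  2 * (suc k * evenCompositions (suc (suc m * 2)) (suc (suc k)))
    ≡⟨ cong (λ x → 2 * (suc k * x)) (evenCompositions-odd (suc m) (suc (suc k))) ⟩
  2 * (suc k * 0)
    ≡⟨ cong (2 *_) (*-zeroʳ (suc k)) ⟩
  0
    ≡⟨ *-zeroʳ (suc (m * 2)) ⟨
  suc (m * 2) * 0
    ≡⟨ cong (suc (m * 2) *_) (evenCompositions-odd m (suc k)) ⟨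
  suc (m * 2) * evenCompositions (suc (m * 2)) (suc k) ∎

nCk*[n∸k]C[i∸k]≡nCi*iCk : ∀ {n i k} → k ≤ i → i ≤ n → (n C k) * ((n ∸ k) C (i ∸ k)) ≡ (n C i) * (i C k)
nCk*[n∸k]C[i∸k]≡nCi*iCk {n} {i} {k} k≤i i≤n = begin
  (n C k) * ((n ∸ k) C b)
    ≡⟨ cong (λ m → (m C k) * ((m ∸ k) C b)) n≡ ⟨
  ((k + b + c) C k) * ((k + b + c ∸ k) C b)
    ≡⟨ cong (λ m → ((k + b + c) C k) * ((m ∸ k) C b)) (+-assoc k b c) ⟩
  ((k + b + c) C k) * ((k + (b + c) ∸ k) C b)
    ≡⟨ cong (λ m → ((k + b + c) C k) * (m C b)) (m+n∸m≡n k (b + c)) ⟩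
  ((k + b + c) C k) * ((b + c) C b)
    ≡⟨ [a+b+c]Ca*[b+c]Cb≡[a+b+c]C[a+b]*[a+b]Ca k b c ⟩
  ((k + b + c) C (k + b)) * ((k + b) C k)
    ≡⟨ cong₂ (λ m j → (m C j) * (j C k)) n≡ i≡ ⟩
  (n C i) * (i C k) ∎
  where
  b = i ∸ k
  c = n ∸ i
  i≡ : k + b ≡ i
  i≡ = m+[n∸m]≡n k≤i
  n≡ : k + b + c ≡ n
  n≡ = trans (cong (_+ c) i≡) (m+[n∸m]≡n i≤n)

-- Counting the states of the scan

if-<ᵇ-true : ∀ {a} {A : Set a} {ℓ u} {x y : A} → ℓ < u → (if ℓ <ᵇ u then x else y) ≡ x
if-<ᵇ-true {ℓ = zero}  {suc u} _         = refl
if-<ᵇ-true {ℓ = suc ℓ} {suc u} (s≤s ℓ<u) = if-<ᵇ-true ℓ<u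

if-<ᵇ-false : ∀ {a} {A : Set a} {ℓ u} {x y : A} → u ≤ ℓ → (if ℓ <ᵇ u then x else y) ≡ y
if-<ᵇ-false {ℓ = ℓ}     {zero}  _         = refl
if-<ᵇ-false {ℓ = suc ℓ} {suc u} (s≤s u≤ℓ) = if-<ᵇ-false u≤ℓ

if-then-0 : ∀ b {x : ℕ} → x ≡ 0 → (if b then x else 0) ≡ 0
if-then-0 true  x≡0 = x≡0
if-then-0 false _   = refl

-- #X u ℓ i k is the length of Scan.X n u ℓ i k for every n: the number of states of kind X
-- with ℓ letters written, i left-to-right minima and k ascents. The guard ℓ < u says that
-- some scanned value is still pending, so that there is a letter to emit.
#start : ℕ → ℕ → ℕ → ℕ → ℕ
#start zero    zero    zero    zero    = 1
#start zero    zero    zero    (suc k) = 0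
#start zero    zero    (suc i) k       = 0
#start zero    (suc ℓ) i       k       = 0
#start (suc u) ℓ       i       k       = 0

mutual
  #closed : ℕ → ℕ → ℕ → ℕ → ℕ
  #closed u ℓ i k = #start u ℓ i k + (#opened u ℓ i k + #evenOpen u ℓ i k)

  #ready : ℕ → ℕ → ℕ → ℕ → ℕ
  #ready zero    ℓ i k = 0
  #ready (suc u) ℓ i k = #closed u ℓ i k + #ready u ℓ i k

  #opened : ℕ → ℕ → ℕ → ℕ → ℕ
  #opened u zero    i       k = 0
  #opened u (suc ℓ) zero    k = 0
  #opened u (suc ℓ) (suc i) k = #ready u ℓ i k

  #oddOpen : ℕ → ℕ → ℕ → ℕ → ℕ
  #oddOpen u zero    i k       = 0
  #oddOpen u (suc ℓ) i zero    = if ℓ <ᵇ u then #evenOpen u ℓ i zero else 0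
  #oddOpen u (suc ℓ) i (suc k) = if ℓ <ᵇ u then #opened u ℓ i k + #evenOpen u ℓ i (suc k) else 0

  #evenOpen : ℕ → ℕ → ℕ → ℕ → ℕ
  #evenOpen u zero    i k = 0
  #evenOpen u (suc ℓ) i k = if ℓ <ᵇ u then #oddOpen u ℓ i k else 0

#start[u,1+ℓ]≡0 : ∀ u ℓ i k → #start u (suc ℓ) i k ≡ 0
#start[u,1+ℓ]≡0 zero    ℓ i k = refl
#start[u,1+ℓ]≡0 (suc u) ℓ i k = refl

#start[u,ℓ,1+i]≡0 : ∀ u ℓ i k → #start u ℓ (suc i) k ≡ 0
#start[u,ℓ,1+i]≡0 zero    zero    i k = refl
#start[u,ℓ,1+i]≡0 zero    (suc ℓ) i k = refl
#start[u,ℓ,1+i]≡0 (suc u) ℓ       i k = refl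

#start[u,ℓ,i,1+k]≡0 : ∀ u ℓ i k → #start u ℓ i (suc k) ≡ 0
#start[u,ℓ,i,1+k]≡0 zero    zero    zero    k = refl
#start[u,ℓ,i,1+k]≡0 zero    zero    (suc i) k = refl
#start[u,ℓ,i,1+k]≡0 zero    (suc ℓ) i       k = refl
#start[u,ℓ,i,1+k]≡0 (suc u) ℓ       i       k = refl

mutual
  u≤ℓ⇒#ready≡0 : ∀ u ℓ i k → u ≤ ℓ → #ready u ℓ i k ≡ 0
  u≤ℓ⇒#ready≡0 zero    ℓ i k _   = refl
  u≤ℓ⇒#ready≡0 (suc u) ℓ i k u<ℓ =
    cong₂ _+_ (u<ℓ⇒#closed≡0 u ℓ i k u<ℓ) (u≤ℓ⇒#ready≡0 u ℓ i k (<⇒≤ u<ℓ))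

  u<ℓ⇒#closed≡0 : ∀ u ℓ i k → u < ℓ → #closed u ℓ i k ≡ 0
  u<ℓ⇒#closed≡0 u (suc ℓ) i k u<ℓ =
    cong₂ _+_ (#start[u,1+ℓ]≡0 u ℓ i k)
      (cong₂ _+_ (u<ℓ⇒#opened≡0 u (suc ℓ) i k u<ℓ) (u<ℓ⇒#evenOpen≡0 u (suc ℓ) i k u<ℓ))

  u<ℓ⇒#opened≡0 : ∀ u ℓ i k → u < ℓ → #opened u ℓ i k ≡ 0
  u<ℓ⇒#opened≡0 u (suc ℓ) zero    k _         = refl
  u<ℓ⇒#opened≡0 u (suc ℓ) (suc i) k (s≤s u≤ℓ) = u≤ℓ⇒#ready≡0 u ℓ i k u≤ℓ

  u<ℓ⇒#evenOpen≡0 : ∀ u ℓ i k → u < ℓ → #evenOpen u ℓ i k ≡ 0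
  u<ℓ⇒#evenOpen≡0 u (suc ℓ) i k (s≤s u≤ℓ) = if-<ᵇ-false u≤ℓ

mutual
  i<k⇒#ready≡0 : ∀ u ℓ i k → i < k → #ready u ℓ i k ≡ 0
  i<k⇒#ready≡0 zero    ℓ i k _   = refl
  i<k⇒#ready≡0 (suc u) ℓ i k i<k =
    cong₂ _+_ (i<k⇒#closed≡0 u ℓ i k i<k) (i<k⇒#ready≡0 u ℓ i k i<k)

  i<k⇒#closed≡0 : ∀ u ℓ i k → i < k → #closed u ℓ i k ≡ 0
  i<k⇒#closed≡0 u ℓ i (suc k) i<k =
    cong₂ _+_ (#start[u,ℓ,i,1+k]≡0 u ℓ i k)
      (cong₂ _+_ (i≤k⇒#opened≡0 u ℓ i (suc k) (<⇒≤ i<k)) (i<k⇒#evenOpen≡0 u ℓ i (suc k) i<k))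

  i≤k⇒#opened≡0 : ∀ u ℓ i k → i ≤ k → #opened u ℓ i k ≡ 0
  i≤k⇒#opened≡0 u zero    i       k _ = refl
  i≤k⇒#opened≡0 u (suc ℓ) zero    k _ = refl
  i≤k⇒#opened≡0 u (suc ℓ) (suc i) k i<k = i<k⇒#ready≡0 u ℓ i k i<k

  i<k⇒#evenOpen≡0 : ∀ u ℓ i k → i < k → #evenOpen u ℓ i k ≡ 0
  i<k⇒#evenOpen≡0 u zero    i k _   = refl
  i<k⇒#evenOpen≡0 u (suc ℓ) i k i<k = if-then-0 (ℓ <ᵇ u) (i<k⇒#oddOpen≡0 u ℓ i k i<k)

  i<k⇒#oddOpen≡0 : ∀ u ℓ i k → i < k → #oddOpen u ℓ i k ≡ 0
  i<k⇒#oddOpen≡0 u zero    i k       _         = refl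
  i<k⇒#oddOpen≡0 u (suc ℓ) i (suc k) (s≤s i≤k) =
    if-then-0 (ℓ <ᵇ u) (cong₂ _+_ (i≤k⇒#opened≡0 u ℓ i k i≤k) (i<k⇒#evenOpen≡0 u ℓ i (suc k) (s≤s i≤k)))

mutual
  ℓ<i⇒#ready≡0 : ∀ u ℓ i k → ℓ < i → #ready u ℓ i k ≡ 0
  ℓ<i⇒#ready≡0 zero    ℓ i k _   = refl
  ℓ<i⇒#ready≡0 (suc u) ℓ i k ℓ<i =
    cong₂ _+_ (ℓ<i⇒#closed≡0 u ℓ i k ℓ<i) (ℓ<i⇒#ready≡0 u ℓ i k ℓ<i)

  ℓ<i⇒#closed≡0 : ∀ u ℓ i k → ℓ < i → #closed u ℓ i k ≡ 0
  ℓ<i⇒#closed≡0 u ℓ (suc i) k ℓ<i =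
    cong₂ _+_ (#start[u,ℓ,1+i]≡0 u ℓ i k)
      (cong₂ _+_ (ℓ<i⇒#opened≡0 u ℓ (suc i) k ℓ<i)
                 (ℓ≤1+i⇒#evenOpen≡0 u ℓ (suc i) k (m≤n⇒m≤1+n (<⇒≤ ℓ<i))))

  ℓ<i⇒#opened≡0 : ∀ u ℓ i k → ℓ < i → #opened u ℓ i k ≡ 0
  ℓ<i⇒#opened≡0 u zero    i       k _         = refl
  ℓ<i⇒#opened≡0 u (suc ℓ) (suc i) k (s≤s ℓ<i) = ℓ<i⇒#ready≡0 u ℓ i k ℓ<i

  ℓ≤i⇒#oddOpen≡0 : ∀ u ℓ i k → ℓ ≤ i → #oddOpen u ℓ i k ≡ 0
  ℓ≤i⇒#oddOpen≡0 u zero    i k       _   = refl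
  ℓ≤i⇒#oddOpen≡0 u (suc ℓ) i zero    ℓ<i =
    if-then-0 (ℓ <ᵇ u) (ℓ≤1+i⇒#evenOpen≡0 u ℓ i zero (m≤n⇒m≤1+n (<⇒≤ ℓ<i)))
  ℓ≤i⇒#oddOpen≡0 u (suc ℓ) i (suc k) ℓ<i =
    if-then-0 (ℓ <ᵇ u)
      (cong₂ _+_ (ℓ<i⇒#opened≡0 u ℓ i k ℓ<i)
                 (ℓ≤1+i⇒#evenOpen≡0 u ℓ i (suc k) (m≤n⇒m≤1+n (<⇒≤ ℓ<i))))

  ℓ≤1+i⇒#evenOpen≡0 : ∀ u ℓ i k → ℓ ≤ suc i → #evenOpen u ℓ i k ≡ 0
  ℓ≤1+i⇒#evenOpen≡0 u zero    i k _         = refl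
  ℓ≤1+i⇒#evenOpen≡0 u (suc ℓ) i k (s≤s ℓ≤i) = if-then-0 (ℓ <ᵇ u) (ℓ≤i⇒#oddOpen≡0 u ℓ i k ℓ≤i)

mutual
  #evenOpen[u,ℓ,i,0]≡0 : ∀ u ℓ i → #evenOpen u ℓ i 0 ≡ 0
  #evenOpen[u,ℓ,i,0]≡0 u zero    i = refl
  #evenOpen[u,ℓ,i,0]≡0 u (suc ℓ) i = if-then-0 (ℓ <ᵇ u) (#oddOpen[u,ℓ,i,0]≡0 u ℓ i)

  #oddOpen[u,ℓ,i,0]≡0 : ∀ u ℓ i → #oddOpen u ℓ i 0 ≡ 0
  #oddOpen[u,ℓ,i,0]≡0 u zero    i = refl
  #oddOpen[u,ℓ,i,0]≡0 u (suc ℓ) i = if-then-0 (ℓ <ᵇ u) (#evenOpen[u,ℓ,i,0]≡0 u ℓ i)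

-- Ballot-type closed forms: a ready state with ℓ = i + t letters after u scans has
-- u − 1 − ℓ = s − 1 pending values.
ReadyFormula : ℕ → Set
ReadyFormula u = ∀ i k t s → u ≡ i + t + s →
  u * #ready u (i + t) i k ≡ s * (u C i) * (i C k) * evenCompositions t k

EvenOpenFormula : ℕ → Set
EvenOpenFormula u = ∀ i k t s → u ≡ suc i + t + s →
  u * #evenOpen u (suc i + t) (suc i) (suc k)
    ≡ (u C i) * (i C k) * (suc s * evenCompositions t (suc k) + 2 * evenCompositions (2 + t) (2 + k))

#evenOpen-step : ∀ u ℓ i k → 2 + ℓ < u →
  #evenOpen u (3 + ℓ) (suc i) (suc k) ≡ #ready u ℓ i k + #evenOpen u (suc ℓ) (suc i) (suc k)
#evenOpen-step u ℓ i k 2+ℓ<u = trans (if-<ᵇ-true 2+ℓ<u) (if-<ᵇ-true (<-trans (n<1+n (suc ℓ)) 2+ℓ<u))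

no-even-run : ∀ u i k s {ℓ} → ℓ ≤ 2 + i →
  u * #evenOpen u ℓ (suc i) (suc k) ≡ (u C i) * (i C k) * (suc s * 0 + 2 * 0)
no-even-run u i k s {ℓ} ℓ≤2+i = begin
  u * #evenOpen u ℓ (suc i) (suc k)        ≡⟨ cong (u *_) (ℓ≤1+i⇒#evenOpen≡0 u ℓ (suc i) (suc k) ℓ≤2+i) ⟩
  u * 0                                    ≡⟨ *-zeroʳ u ⟩
  0                                        ≡⟨ annihilate (u C i) (i C k) s ⟨
  (u C i) * (i C k) * (suc s * 0 + 2 * 0)  ∎
  where
  annihilate : ∀ x y s → x * y * (suc s * 0 + 2 * 0) ≡ 0
  annihilate = solve-∀

evenOpenFormula : ∀ u → ReadyFormula u → EvenOpenFormula u
evenOpenFormula u _ i k zero       s _ = no-even-run u i k s (m≤n⇒m≤1+n (≤-reflexive (+-identityʳ (suc i))))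
evenOpenFormula u _ i k (suc zero) s _ = no-even-run u i k s (≤-reflexive (+-comm (suc i) 1))
evenOpenFormula u ready i k (suc (suc t)) s u≡ = begin
  u * #evenOpen u (suc i + suc (suc t)) (suc i) (suc k)
    ≡⟨ cong (λ ℓ → u * #evenOpen u ℓ (suc i) (suc k)) (ℓ≡ i t) ⟩
  u * #evenOpen u (3 + (i + t)) (suc i) (suc k)
    ≡⟨ cong (u *_) (#evenOpen-step u (i + t) i k 2+i+t<u) ⟩
  u * (#ready u (i + t) i k + #evenOpen u (suc i + t) (suc i) (suc k))
    ≡⟨ *-distribˡ-+ u _ _ ⟩
  u * #ready u (i + t) i k + u * #evenOpen u (suc i + t) (suc i) (suc k)
    ≡⟨ cong₂ _+_ (ready i k t (3 + s) (trans u≡ (u≡₁ i t s)))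
                 (evenOpenFormula u ready i k t (2 + s) (trans u≡ (u≡₂ i t s))) ⟩
  (3 + s) * X * Y * d₀ + X * Y * ((3 + s) * d₁ + 2 * d₂)
    ≡⟨ collect s X Y d₀ d₁ d₂ ⟩
  X * Y * (suc s * (d₀ + d₁) + 2 * ((d₀ + d₁) + d₂)) ∎
  where
  X  = u C i
  Y  = i C k
  d₀ = evenCompositions t k
  d₁ = evenCompositions t (suc k)
  d₂ = evenCompositions (2 + t) (2 + k)
  ℓ≡ : ∀ i t → suc i + suc (suc t) ≡ 3 + (i + t)
  ℓ≡ = solve-∀
  u≡₁ : ∀ i t s → suc i + suc (suc t) + s ≡ i + t + (3 + s)
  u≡₁ = solve-∀
  u≡₂ : ∀ i t s → suc i + suc (suc t) + s ≡ suc i + t + (2 + s)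
  u≡₂ = solve-∀
  2+i+t<u : 2 + (i + t) < u
  2+i+t<u = ≤-trans (≤-reflexive (sym (ℓ≡ i t))) (≤-trans (m≤m+n _ s) (≤-reflexive (sym u≡)))
  collect : ∀ s X Y a b c → (3 + s) * X * Y * a + X * Y * ((3 + s) * b + 2 * c)
                          ≡ X * Y * (suc s * (a + b) + 2 * ((a + b) + c))
  collect = solve-∀

ready-recurrence-sum : ∀ i j k t s x y d e → j + k ≡ i → 2 * (k * e) ≡ t * d →
  (i * x) * (j * y) * (suc s * d) + (i * x) * (k * y) * (suc s * d + 2 * e) + (suc (t + s) * x) * (i * s * y * d)
  ≡ (i + t + s) * (i * (suc s * x * y * d))
ready-recurrence-sum ._ j k t s x y d e refl 2ke≡td = begin
  ((j + k) * x) * (j * y) * (suc s * d) + ((j + k) * x) * (k * y) * (suc s * d + 2 * e)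
    + (suc (t + s) * x) * ((j + k) * s * y * d)
    ≡⟨ split j k t s x y d e ⟩
  (j + k) * x * y * ((j + k) * suc s * d + s * suc (t + s) * d) + (j + k) * x * y * (2 * (k * e))
    ≡⟨ cong (λ z → (j + k) * x * y * ((j + k) * suc s * d + s * suc (t + s) * d) + (j + k) * x * y * z) 2ke≡td ⟩
  (j + k) * x * y * ((j + k) * suc s * d + s * suc (t + s) * d) + (j + k) * x * y * (t * d)
    ≡⟨ merge j k t s x y d ⟩
  (j + k + t + s) * ((j + k) * (suc s * x * y * d)) ∎
  where
  split : ∀ j k t s x y d e →
    ((j + k) * x) * (j * y) * (suc s * d) + ((j + k) * x) * (k * y) * (suc s * d + 2 * e)
      + (suc (t + s) * x) * ((j + k) * s * y * d)
    ≡ (j + k) * x * y * ((j + k) * suc s * d + s * suc (t + s) * d) + (j + k) * x * y * (2 * (k * e))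
  split = solve-∀
  merge : ∀ j k t s x y d →
    (j + k) * x * y * ((j + k) * suc s * d + s * suc (t + s) * d) + (j + k) * x * y * (t * d)
    ≡ (j + k + t + s) * ((j + k) * (suc s * x * y * d))
  merge = solve-∀

-- The three summands of #ready (u + 1) = #opened u + #evenOpen u + #ready u; multiplied by
-- u·i they become multiples of C(u + 1, i)·C(i, k) by absorption and complementation.
ready-recurrence-identity : ∀ u i′ k t s Q d₂ {E₀ E₁ V} → let i = suc i′; d = evenCompositions t k in
  k ≤ i → u ≡ i + t + s →
  i * Q ≡ k * (i C k) → 2 * (k * d₂) ≡ t * d →
  u * E₀ ≡ suc s * (u C i′) * (i′ C k) * d →
  u * E₁ ≡ (u C i′) * Q * (suc s * d + 2 * d₂) →
  u * V ≡ s * (u C i) * (i C k) * d →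
  suc u * (E₀ + E₁ + V) ≡ suc s * (suc u C i) * (i C k) * d
ready-recurrence-identity ._ i′ k t s Q d₂ {E₀} {E₁} {V} k≤i refl iQ≡kY 2kd₂≡td IH₀ IH₁ IHᵥ =
  *-cancelˡ-≡ _ _ i (*-cancelˡ-≡ _ _ u (begin
    u * (i * (suc u * (E₀ + E₁ + V)))
      ≡⟨ expand u i E₀ E₁ V ⟩
    i * suc u * (u * E₀) + i * suc u * (u * E₁) + i * suc u * (u * V)
      ≡⟨ cong₂ _+_ (cong₂ _+_ (cong (i * suc u *_) IH₀) (cong (i * suc u *_) IH₁)) (cong (i * suc u *_) IHᵥ) ⟩
    i * suc u * (suc s * A * P * d) + i * suc u * (A * Q * (suc s * d + 2 * d₂)) + i * suc u * (s * B * Y * d)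
      ≡⟨ regroup i (suc u) s A P Q B Y d d₂ ⟩
    (suc u * A) * (i * P) * (suc s * d) + (suc u * A) * (i * Q) * (suc s * d + 2 * d₂) + (suc u * B) * (i * s * Y * d)
      ≡⟨ cong₂ _+_ (cong₂ _+_ (cong₂ (λ a p → a * p * (suc s * d)) absorb complementᵢ)
                              (cong₂ (λ a q → a * q * (suc s * d + 2 * d₂)) absorb iQ≡kY))
                   (cong (_* (i * s * Y * d)) (trans complementᵤ (cong (_* X) 1+u∸i≡1+t+s))) ⟩
    (i * X) * ((i ∸ k) * Y) * (suc s * d) + (i * X) * (k * Y) * (suc s * d + 2 * d₂) + (suc (t + s) * X) * (i * s * Y * d)
      ≡⟨ ready-recurrence-sum i (i ∸ k) k t s X Y d d₂ (m∸n+n≡m k≤i) 2kd₂≡td ⟩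
    u * (i * (suc s * X * Y * d)) ∎))
  where
  i = suc i′
  u = i + t + s
  d = evenCompositions t k
  A = u C i′
  P = i′ C k
  B = u C i
  X = suc u C i
  Y = i C k
  absorb : suc u * A ≡ i * X
  absorb = [1+n]*nCk≡[1+k]*[1+n]C[1+k] u i′
  complementᵢ : i * P ≡ (i ∸ k) * Y
  complementᵢ = [1+n]*nCk≡[1+n∸k]*[1+n]Ck i′ k
  complementᵤ : suc u * B ≡ (suc u ∸ i) * X
  complementᵤ = [1+n]*nCk≡[1+n∸k]*[1+n]Ck u i
  u≡i′+[1+t+s] : ∀ i′ t s → suc i′ + t + s ≡ i′ + suc (t + s)
  u≡i′+[1+t+s] = solve-∀
  1+u∸i≡1+t+s : suc u ∸ i ≡ suc (t + s)
  1+u∸i≡1+t+s = trans (cong (_∸ i′) (u≡i′+[1+t+s] i′ t s)) (m+n∸m≡n i′ (suc (t + s)))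
  expand : ∀ u i a b c → u * (i * (suc u * (a + b + c)))
                       ≡ i * suc u * (u * a) + i * suc u * (u * b) + i * suc u * (u * c)
  expand = solve-∀
  regroup : ∀ i u s a p q b y d e →
    i * u * (suc s * a * p * d) + i * u * (a * q * (suc s * d + 2 * e)) + i * u * (s * b * y * d)
    ≡ (u * a) * (i * p) * (suc s * d) + (u * a) * (i * q) * (suc s * d + 2 * e) + (u * b) * (i * s * y * d)
  regroup = solve-∀

ready-recurrence-identity₀ : ∀ u t s r d .{{_ : NonZero u}} → u ≡ t + s → t * d ≡ 0 →
  u * r ≡ s * 1 * 1 * d → suc u * r ≡ suc s * 1 * 1 * d
ready-recurrence-identity₀ ._ t s r d refl td≡0 IH = *-cancelˡ-≡ _ _ (t + s) (begin
  (t + s) * (suc (t + s) * r)           ≡⟨ swap t s r ⟩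
  suc (t + s) * ((t + s) * r)           ≡⟨ cong (suc (t + s) *_) IH ⟩
  suc (t + s) * (s * 1 * 1 * d)         ≡⟨ +-identityʳ _ ⟨
  suc (t + s) * (s * 1 * 1 * d) + 0     ≡⟨ cong (suc (t + s) * (s * 1 * 1 * d) +_) td≡0 ⟨
  suc (t + s) * (s * 1 * 1 * d) + t * d ≡⟨ merge t s d ⟩
  (t + s) * (suc s * 1 * 1 * d)         ∎)
  where
  swap : ∀ t s r → (t + s) * (suc (t + s) * r) ≡ suc (t + s) * ((t + s) * r)
  swap = solve-∀
  merge : ∀ t s d → suc (t + s) * (s * 1 * 1 * d) + t * d ≡ (t + s) * (suc s * 1 * 1 * d)
  merge = solve-∀

vanishing : ∀ m a d {r y} → r ≡ 0 → y ≡ 0 → m * r ≡ a * y * d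
vanishing m a d refl refl = trans (*-zeroʳ m) (sym (annihilate a d))
  where
  annihilate : ∀ a d → a * 0 * d ≡ 0
  annihilate = solve-∀

readyFormula-step : ∀ u → ReadyFormula u → EvenOpenFormula u → ∀ i k t s → u ≡ i + t + s →
  suc u * #ready (suc u) (i + t) i k ≡ suc s * (suc u C i) * (i C k) * evenCompositions t k
readyFormula-step zero    _ _ zero    zero    zero    zero    refl = refl
readyFormula-step zero    _ _ zero    (suc k) zero    zero    refl = refl
readyFormula-step zero    _ _ zero    k       zero    (suc s) ()
readyFormula-step zero    _ _ zero    k       (suc t) s       ()
readyFormula-step zero    _ _ (suc i) k       t       s       ()
readyFormula-step (suc u) ready _ zero zero t s u≡ =
  ready-recurrence-identity₀ (suc u) t s _ (evenCompositions t 0) u≡ (t*evenCompositions[t,0]≡0 t)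
    (trans (cong (λ c → suc u * (c + #ready (suc u) t 0 0))
                 (cong₂ _+_ (i≤k⇒#opened≡0 (suc u) t 0 0 z≤n) (#evenOpen[u,ℓ,i,0]≡0 (suc u) t 0)))
           (ready 0 0 t s u≡))
readyFormula-step (suc u) _ _ zero (suc k) t s _ =
  vanishing (suc (suc u)) (suc s * 1) (evenCompositions t (suc k)) (i<k⇒#ready≡0 (suc (suc u)) t 0 (suc k) z<s) refl
readyFormula-step (suc u) ready evenOpen (suc i) zero t s u≡ =
  ready-recurrence-identity (suc u) i 0 t s 0 0 z≤n u≡ (*-zeroʳ (suc i)) (sym (t*evenCompositions[t,0]≡0 t))
    (ready i 0 t (suc s) (trans u≡ (sym (+-suc (i + t) s))))
    (vanishing (suc u) (suc u C i) (suc s * evenCompositions t 0 + 2 * 0)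
      (#evenOpen[u,ℓ,i,0]≡0 (suc u) (suc i + t) (suc i)) refl)
    (ready (suc i) 0 t s u≡)
readyFormula-step (suc u) ready evenOpen (suc i) (suc k) t s u≡ with suc k ≤? suc i
... | no k≰i =
  vanishing (suc (suc u)) (suc s * (suc (suc u) C suc i)) (evenCompositions t (suc k))
    (i<k⇒#ready≡0 (suc (suc u)) (suc i + t) (suc i) (suc k) (≰⇒> k≰i)) (k>n⇒nCk≡0 (≰⇒> k≰i))
... | yes k≤i =
  ready-recurrence-identity (suc u) i (suc k) t s (i C k) (evenCompositions (2 + t) (2 + k)) k≤i u≡
    ([1+n]*nCk≡[1+k]*[1+n]C[1+k] i k) (2*[1+k]*evenCompositions[2+t,2+k]≡t*evenCompositions[t,1+k] t k)
    (ready i (suc k) t (suc s) (trans u≡ (sym (+-suc (i + t) s))))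
    (evenOpen i k t s u≡)
    (ready (suc i) (suc k) t s u≡)

readyFormula : ∀ u → ReadyFormula u
readyFormula zero    i k t s 0≡i+t+s rewrite m+n≡0⇒n≡0 (i + t) (sym 0≡i+t+s) = refl
readyFormula (suc u) i k t zero    u≡i+t+0 =
  trans (cong (suc u *_) (u≤ℓ⇒#ready≡0 (suc u) (i + t) i k (≤-reflexive (trans u≡i+t+0 (+-identityʳ (i + t))))))
        (*-zeroʳ (suc u))
readyFormula (suc u) i k t (suc s) u≡i+t+s+1 =
  readyFormula-step u (readyFormula u) (evenOpenFormula u (readyFormula u)) i k t s
    (suc-injective (trans u≡i+t+s+1 (+-suc (i + t) s)))

#closed-formula : ∀ {n i k} → i ≤ n → suc n * #closed n n i k ≡ (suc n C i) * (i C k) * evenCompositions (n ∸ i) k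
#closed-formula {n} {i} {k} i≤n = begin
  suc n * #closed n n i k
    ≡⟨ cong (suc n *_) (trans (cong (#closed n n i k +_) (u≤ℓ⇒#ready≡0 n n i k ≤-refl)) (+-identityʳ _)) ⟨
  suc n * (#closed n n i k + #ready n n i k)
    ≡⟨ cong (λ ℓ → suc n * #ready (suc n) ℓ i k) (m+[n∸m]≡n i≤n) ⟨
  suc n * #ready (suc n) (i + (n ∸ i)) i k
    ≡⟨ readyFormula (suc n) i k (n ∸ i) 1 (trans (cong suc (sym (m+[n∸m]≡n i≤n))) (+-comm 1 (i + (n ∸ i)))) ⟩
  1 * (suc n C i) * (i C k) * evenCompositions (n ∸ i) k
    ≡⟨ cong (λ x → x * (i C k) * evenCompositions (n ∸ i) k) (*-identityˡ (suc n C i)) ⟩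
  (suc n C i) * (i C k) * evenCompositions (n ∸ i) k ∎

-- Words

private
  variable
    ℓa ℓp : Level
    A : Set ℓa

module _ {P : Pred A ℓp} (P? : Decidable P) where

  takeWhile-++-¬ : ∀ ys {z} zs → ¬ P z → takeWhile P? (ys ++ z ∷ zs) ≡ takeWhile P? ys
  takeWhile-++-¬ []       {z} zs ¬pz with P? z
  ... | yes pz with () ← ¬pz pz
  ... | no _   = refl
  takeWhile-++-¬ (y ∷ ys) zs ¬pz with P? y
  ... | yes _ = cong (y ∷_) (takeWhile-++-¬ ys zs ¬pz)
  ... | no _  = refl

  takeWhile-++-All : ∀ {ys} zs → All P ys → takeWhile P? (ys ++ zs) ≡ ys ++ takeWhile P? zs
  takeWhile-++-All zs []                  = refl
  takeWhile-++-All zs (_∷_ {x = y} py pys) with P? y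
  ... | yes _  = cong (y ∷_) (takeWhile-++-All zs pys)
  ... | no ¬py with () ← ¬py py

  takeWhile-All : ∀ {ys} → All P ys → takeWhile P? ys ≡ ys
  takeWhile-All {ys} pys =
    trans (cong (takeWhile P?) (sym (++-identityʳ ys))) (trans (takeWhile-++-All [] pys) (++-identityʳ ys))

All-ʳ++⁺ : ∀ {P : Pred A ℓp} ws {acc} → All P ws → All P acc → All P (ws ʳ++ acc)
All-ʳ++⁺ []       []         pacc = pacc
All-ʳ++⁺ (w ∷ ws) (pw ∷ pws) pacc = All-ʳ++⁺ ws pws (pw ∷ pacc)

All-ʳ++⁻ : ∀ {P : Pred A ℓp} ws {acc} → All P (ws ʳ++ acc) → All P ws × All P acc
All-ʳ++⁻ []       pacc = [] , pacc
All-ʳ++⁻ (w ∷ ws) p with All-ʳ++⁻ ws p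
... | pws , pw ∷ pacc = pw ∷ pws , pacc

length-∷ʳ : ∀ (ws : List A) x → length (ws ++ [ x ]) ≡ suc (length ws)
length-∷ʳ ws x = trans (length-++ ws) (+-comm (length ws) 1)

⊆-∷ʳ⁻ : ∀ {vs : List A} ws x → vs ⊆ ws ++ [ x ] → vs ⊆ ws ⊎ ∃ λ vs′ → vs ≡ vs′ ++ [ x ] × vs′ ⊆ ws
⊆-∷ʳ⁻ []       x (.x ∷ʳ sub) = inj₁ sub
⊆-∷ʳ⁻ []       x (refl ∷ []) = inj₂ ([] , refl , [])
⊆-∷ʳ⁻ (w ∷ ws) x (.w ∷ʳ sub) with ⊆-∷ʳ⁻ ws x sub
... | inj₁ sub′               = inj₁ (w ∷ʳ sub′)
... | inj₂ (vs′ , refl , sub′) = inj₂ (vs′ , refl , w ∷ʳ sub′)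
⊆-∷ʳ⁻ (w ∷ ws) x (refl ∷ sub) with ⊆-∷ʳ⁻ ws x sub
... | inj₁ sub′               = inj₁ (refl ∷ sub′)
... | inj₂ (vs′ , refl , sub′) = inj₂ (w ∷ vs′ , refl , refl ∷ sub′)

pair-⊆-∷ʳ⁻ : ∀ {a b : A} ws x → (a ∷ b ∷ []) ⊆ ws ++ [ x ] → (a ∷ b ∷ []) ⊆ ws ⊎ (a ∈ ws × b ≡ x)
pair-⊆-∷ʳ⁻ {a = a} ws x sub with ⊆-∷ʳ⁻ ws x sub
... | inj₁ sub′ = inj₁ sub′
... | inj₂ (vs′ , eq , sub′) with ∷ʳ-injective (a ∷ []) vs′ eq
...   | refl , refl = inj₂ (to∈ sub′ , refl)

Unique-++⇒disjoint : ∀ {x : A} xs {ys} → Unique (xs ++ ys) → x ∈ xs → x ∈ ys → ⊥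
Unique-++⇒disjoint (_ ∷ xs) (x∉ ∷ _) (here refl) x∈ys  = All.lookup x∉ (∈-++⁺ʳ xs x∈ys) refl
Unique-++⇒disjoint (_ ∷ xs) (_ ∷ u)  (there x∈xs) x∈ys = Unique-++⇒disjoint xs u x∈xs x∈ys

Unique-↭ : ∀ {xs ys : List ℕ} → xs ↭ ys → Unique xs → Unique ys
Unique-↭ xs↭ys = Unique-resp-↭ (↭⇒↭ₛ xs↭ys)

Unique-oneTo : ∀ m → Unique (oneTo m)
Unique-oneTo m = Uniqueₚ.map⁺ suc-injective (Uniqueₚ.upTo⁺ m)

length-oneTo : ∀ m → length (oneTo m) ≡ m
length-oneTo m = trans (length-map suc (upTo m)) (length-upTo m)

downTo : ℕ → List ℕ
downTo = applyDownFrom suc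

downTo↭oneTo : ∀ m → downTo m ↭ oneTo m
downTo↭oneTo m = subst₂ _↭_ (reverse-applyUpTo suc m) (sym (map-upTo suc m)) (↭-reverse (applyUpTo suc m))

∈downTo⁻ : ∀ {x} m → x ∈ downTo m → ∃ λ x′ → x ≡ suc x′ × x′ < m
∈downTo⁻ (suc m) (here refl) = m , refl , ≤-refl
∈downTo⁻ (suc m) (there x∈) with ∈downTo⁻ m x∈
... | x′ , refl , x′<m = x′ , refl , m<n⇒m<1+n x′<m

rhoLen-++-≤ : ∀ {x} ys {z} zs → z ≤ x → rhoLen x (ys ++ z ∷ zs) ≡ rhoLen x ys
rhoLen-++-≤ {x} ys zs z≤x = cong length (takeWhile-++-¬ (x <?_) ys zs (≤⇒≯ z≤x))

rhoLen-++-above : ∀ {x ys} zs → All (x <_) ys → rhoLen x (ys ++ zs) ≡ length ys + rhoLen x zs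
rhoLen-++-above {x} {ys} zs x<ys = trans (cong length (takeWhile-++-All (x <?_) zs x<ys)) (length-++ ys)

Jacobi-++⁻ʳ : ∀ ws {vs} → Jacobi (ws ++ vs) → Jacobi vs
Jacobi-++⁻ʳ []       jac       = jac
Jacobi-++⁻ʳ (_ ∷ ws) (_ , jac) = Jacobi-++⁻ʳ ws jac

Jacobi-decreasing : ∀ {ws} → AllPairs _>_ ws → Jacobi ws
Jacobi-decreasing []                     = _
Jacobi-decreasing {x ∷ []}    ([] ∷ [])  = 2 ∣0 , _
Jacobi-decreasing {x ∷ y ∷ ws} ((y<x ∷ _) ∷ dec) =
  subst (2 ∣_) (sym (rhoLen-++-≤ [] ws (<⇒≤ y<x))) (2 ∣0) , Jacobi-decreasing dec

Jacobi-++-below : ∀ {ws z vs} → Jacobi ws → All (z <_) ws → Jacobi (z ∷ vs) → Jacobi (ws ++ z ∷ vs)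
Jacobi-++-below {[]}     _           []          jac = jac
Jacobi-++-below {x ∷ ws} (2∣ρ , jac) (z<x ∷ z<ws) jac′ =
  subst (2 ∣_) (sym (rhoLen-++-≤ ws _ (<⇒≤ z<x))) 2∣ρ , Jacobi-++-below jac z<ws jac′

Jacobi-++-block : ∀ {ws μ run} → Jacobi ws → All (μ <_) ws → All (μ <_) run → AllPairs _>_ run →
  2 ∣ length run → Jacobi (ws ++ μ ∷ run)
Jacobi-++-block {μ = μ} jac μ<ws μ<run run↓ 2∣run = Jacobi-++-below jac μ<ws
  (subst (2 ∣_) (sym (cong length (takeWhile-All (μ <?_) μ<run))) 2∣run , Jacobi-decreasing run↓)

Jacobi⇒even-run : ∀ ws {μ run} vs → Jacobi (ws ++ μ ∷ run ++ vs) → All (μ <_) run → rhoLen μ vs ≡ 0 →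
  2 ∣ length run
Jacobi⇒even-run ws {μ} {run} vs jac μ<run ρ≡0 with Jacobi-++⁻ʳ ws jac
... | 2∣ρ , _ =
  subst (2 ∣_) (trans (rhoLen-++-above vs μ<run) (trans (cong (length run +_) ρ≡0) (+-identityʳ _))) 2∣ρ

lrminAux-∷ʳ : ∀ pre ws x →
  lrminAux pre (ws ++ [ x ]) ≡ lrminAux pre ws + (if does (all? (x <?_) (ws ʳ++ pre)) then 1 else 0)
lrminAux-∷ʳ pre []       x = +-identityʳ _
lrminAux-∷ʳ pre (y ∷ ws) x =
  trans (cong (m +_) (lrminAux-∷ʳ (y ∷ pre) ws x)) (sym (+-assoc m (lrminAux (y ∷ pre) ws) _))
  where m = if does (all? (y <?_) pre) then 1 else 0

lrmin-∷ʳ-below : ∀ ws {x} → All (x <_) ws → lrmin (ws ++ [ x ]) ≡ suc (lrmin ws)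
lrmin-∷ʳ-below ws {x} x<ws = begin
  lrmin (ws ++ [ x ])
    ≡⟨ lrminAux-∷ʳ [] ws x ⟩
  lrmin ws + (if does (all? (x <?_) (ws ʳ++ [])) then 1 else 0)
    ≡⟨ cong (λ b → lrmin ws + (if b then 1 else 0)) (dec-true (all? (x <?_) (ws ʳ++ [])) (All-ʳ++⁺ ws x<ws [])) ⟩
  lrmin ws + 1
    ≡⟨ +-comm (lrmin ws) 1 ⟩
  suc (lrmin ws) ∎

lrmin-∷ʳ-above : ∀ {ws x y} → y ∈ ws → y < x → lrmin (ws ++ [ x ]) ≡ lrmin ws
lrmin-∷ʳ-above {ws} {x} y∈ws y<x = begin
  lrmin (ws ++ [ x ])
    ≡⟨ lrminAux-∷ʳ [] ws x ⟩
  lrmin ws + (if does (all? (x <?_) (ws ʳ++ [])) then 1 else 0)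
    ≡⟨ cong (λ b → lrmin ws + (if b then 1 else 0)) (dec-false (all? (x <?_) (ws ʳ++ [])) x≮ws) ⟩
  lrmin ws + 0
    ≡⟨ +-identityʳ (lrmin ws) ⟩
  lrmin ws ∎
  where
  x≮ws : ¬ All (x <_) (ws ʳ++ [])
  x≮ws x<ws = <-asym y<x (All.lookup (proj₁ (All-ʳ++⁻ ws x<ws)) y∈ws)

asc-∷ʳ : ∀ ws y x → asc ((ws ++ [ y ]) ++ [ x ]) ≡ asc (ws ++ [ y ]) + (if does (y <? x) then 1 else 0)
asc-∷ʳ []           y x = +-identityʳ _
asc-∷ʳ (a ∷ [])     y x = trans (cong (m +_) (+-identityʳ _)) (cong (_+ _) (sym (+-identityʳ m)))
  where m = if does (a <? y) then 1 else 0
asc-∷ʳ (a ∷ b ∷ ws) y x =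
  trans (cong (m +_) (asc-∷ʳ (b ∷ ws) y x)) (sym (+-assoc m (asc ((b ∷ ws) ++ [ y ])) _))
  where m = if does (a <? b) then 1 else 0

asc-∷ʳ-ascent : ∀ ws {y x} → y < x → asc ((ws ++ [ y ]) ++ [ x ]) ≡ suc (asc (ws ++ [ y ]))
asc-∷ʳ-ascent ws {y} {x} y<x = trans (asc-∷ʳ ws y x)
  (trans (cong (λ b → asc (ws ++ [ y ]) + (if b then 1 else 0)) (dec-true (y <? x) y<x)) (+-comm (asc (ws ++ [ y ])) 1))

asc-∷ʳ-descent : ∀ ws {y x} → x < y → asc ((ws ++ [ y ]) ++ [ x ]) ≡ asc (ws ++ [ y ])
asc-∷ʳ-descent ws {y} {x} x<y = trans (asc-∷ʳ ws y x)
  (trans (cong (λ b → asc (ws ++ [ y ]) + (if b then 1 else 0)) (dec-false (y <? x) (<-asym x<y))) (+-identityʳ _))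

asc-∷ʳ-below : ∀ ws {x} → All (x <_) ws → asc (ws ++ [ x ]) ≡ asc ws
asc-∷ʳ-below ws x<ws with initLast ws
... | []        = refl
... | ws′ ∷ʳ′ y = asc-∷ʳ-descent ws′ (All.lookup x<ws (∈-++⁺ʳ ws′ (here refl)))

Avoids123-∷ʳ : ∀ {ws x} → Avoids123 ws → (∀ a b → (a ∷ b ∷ []) ⊆ ws → a < b → x < b) → Avoids123 (ws ++ [ x ])
Avoids123-∷ʳ {ws} {x} avoid x<ascent a b c sub (a<b , b<c) with ⊆-∷ʳ⁻ ws x sub
... | inj₁ sub′ = avoid a b c sub′ (a<b , b<c)
... | inj₂ (vs′ , eq , sub′) with ∷ʳ-injective (a ∷ b ∷ []) vs′ eq
...   | refl , refl = <-asym b<c (x<ascent a b sub′ a<b)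

-- The scan of the values n, n − 1, …, 1. A state (w , P) consists of the written prefix w
-- and the deferred values P, to be written largest first. After u scanned values the last
-- run of w is empty (`opened`), of odd length (`oddOpen`) or of nonzero even length
-- (`evenOpen`); `closed` collects the states whose run may end, and `ready u` those in which
-- the value n + 1 − u is scanned next.
module Scan (n : ℕ) where

  State : Set
  State = List ℕ × List ℕ

  write : ℕ → State → State
  write v (w , P) = (w ++ [ v ] , P)

  defer : ℕ → State → State
  defer v (w , P) = (w , P ++ [ v ])

  -- The junk letter 0 is never written: emission is guarded by ℓ < u, which forces P ≠ []
  -- (`emit-sound`).
  emit : State → State
  emit (w , [])    = (w ++ [ 0 ] , [])
  emit (w , h ∷ P) = (w ++ [ h ] , P)

  start : ℕ → ℕ → ℕ → ℕ → List State
  start zero    zero    zero    zero    = [ [] , [] ]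
  start zero    zero    zero    (suc k) = []
  start zero    zero    (suc i) k       = []
  start zero    (suc ℓ) i       k       = []
  start (suc u) ℓ       i       k       = []

  mutual
    closed : ℕ → ℕ → ℕ → ℕ → List State
    closed u ℓ i k = start u ℓ i k ++ (opened u ℓ i k ++ evenOpen u ℓ i k)

    ready : ℕ → ℕ → ℕ → ℕ → List State
    ready zero    ℓ i k = []
    ready (suc u) ℓ i k = closed u ℓ i k ++ map (defer (suc n ∸ u)) (ready u ℓ i k)

    opened : ℕ → ℕ → ℕ → ℕ → List State
    opened u zero    i       k = []
    opened u (suc ℓ) zero    k = []
    opened u (suc ℓ) (suc i) k = map (write (suc n ∸ u)) (ready u ℓ i k)

    oddOpen : ℕ → ℕ → ℕ → ℕ → List State
    oddOpen u zero    i k       = []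
    oddOpen u (suc ℓ) i zero    = if ℓ <ᵇ u then map emit (evenOpen u ℓ i zero) else []
    oddOpen u (suc ℓ) i (suc k) = if ℓ <ᵇ u then map emit (opened u ℓ i k ++ evenOpen u ℓ i (suc k)) else []

    evenOpen : ℕ → ℕ → ℕ → ℕ → List State
    evenOpen u zero    i k = []
    evenOpen u (suc ℓ) i k = if ℓ <ᵇ u then map emit (oddOpen u ℓ i k) else []

  length-if : ∀ {A : Set} b (xs : List A) {m} → length xs ≡ m → length (if b then xs else []) ≡ (if b then m else 0)
  length-if b xs refl = if-float length b

  length-start : ∀ u ℓ i k → length (start u ℓ i k) ≡ #start u ℓ i k
  length-start zero    zero    zero    zero    = refl
  length-start zero    zero    zero    (suc k) = refl
  length-start zero    zero    (suc i) k       = refl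
  length-start zero    (suc ℓ) i       k       = refl
  length-start (suc u) ℓ       i       k       = refl

  mutual
    length-closed : ∀ u ℓ i k → length (closed u ℓ i k) ≡ #closed u ℓ i k
    length-closed u ℓ i k =
      trans (length-++ (start u ℓ i k))
        (cong₂ _+_ (length-start u ℓ i k)
          (trans (length-++ (opened u ℓ i k)) (cong₂ _+_ (length-opened u ℓ i k) (length-evenOpen u ℓ i k))))

    length-ready : ∀ u ℓ i k → length (ready u ℓ i k) ≡ #ready u ℓ i k
    length-ready zero    ℓ i k = refl
    length-ready (suc u) ℓ i k =
      trans (length-++ (closed u ℓ i k))
        (cong₂ _+_ (length-closed u ℓ i k) (trans (length-map _ (ready u ℓ i k)) (length-ready u ℓ i k)))

    length-opened : ∀ u ℓ i k → length (opened u ℓ i k) ≡ #opened u ℓ i k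
    length-opened u zero    i       k = refl
    length-opened u (suc ℓ) zero    k = refl
    length-opened u (suc ℓ) (suc i) k = trans (length-map _ (ready u ℓ i k)) (length-ready u ℓ i k)

    length-oddOpen : ∀ u ℓ i k → length (oddOpen u ℓ i k) ≡ #oddOpen u ℓ i k
    length-oddOpen u zero    i k       = refl
    length-oddOpen u (suc ℓ) i zero    =
      length-if (ℓ <ᵇ u) _ (trans (length-map emit (evenOpen u ℓ i zero)) (length-evenOpen u ℓ i zero))
    length-oddOpen u (suc ℓ) i (suc k) =
      length-if (ℓ <ᵇ u) _
        (trans (length-map emit (opened u ℓ i k ++ evenOpen u ℓ i (suc k)))
          (trans (length-++ (opened u ℓ i k)) (cong₂ _+_ (length-opened u ℓ i k) (length-evenOpen u ℓ i (suc k)))))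

    length-evenOpen : ∀ u ℓ i k → length (evenOpen u ℓ i k) ≡ #evenOpen u ℓ i k
    length-evenOpen u zero    i k = refl
    length-evenOpen u (suc ℓ) i k =
      length-if (ℓ <ᵇ u) _ (trans (length-map emit (oddOpen u ℓ i k)) (length-oddOpen u ℓ i k))

  -- A state (w , P) once the values above lo are scanned: w is the written prefix of the
  -- permutation, P the decreasing list of scanned values still to be written (all above pb),
  -- and downTo lo the values not yet scanned.
  record Invariant (lo pb : ℕ) (w P : List ℕ) (ℓ i k : ℕ) : Set where
    field
      perm      : w ++ P ++ downTo lo ↭ oneTo n
      pending↓  : AllPairs _>_ P
      pending>  : All (pb <_) P
      written>  : All (lo <_) w
      ascent>P  : ∀ a b → (a ∷ b ∷ []) ⊆ w → a < b → All (_< b) P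
      avoids    : Avoids123 w
      lrmin≡    : lrmin w ≡ i
      asc≡      : asc w ≡ k
      length≡   : length w ≡ ℓ

  data BlockState : Set where
    emptyBlock evenBlock oddBlock : BlockState

  next : BlockState → BlockState
  next emptyBlock = oddBlock
  next evenBlock  = oddBlock
  next oddBlock   = evenBlock

  Parity : BlockState → List ℕ → Set
  Parity emptyBlock run = run ≡ []
  Parity evenBlock  run = ∃ λ m → length run ≡ 2 * m
  Parity oddBlock   run = ∃ λ m → length run ≡ suc (2 * m)

  record Block (st : BlockState) (lo : ℕ) (w P : List ℕ) : Set where
    field
      before run : List ℕ
      shape      : w ≡ before ++ suc lo ∷ run
      jacobi     : Jacobi before
      before>    : All (suc lo <_) before
      run>       : All (suc lo <_) run
      run↓       : AllPairs _>_ run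
      run>P      : All (λ b → All (_< b) P) run
      runParity  : Parity st run
      last       : st ≢ emptyBlock → ∃₂ λ w′ b → w ≡ w′ ++ [ b ] × suc lo < b × All (_< b) P

  Invariant-defer : ∀ {lo w P ℓ i k} → Invariant (suc lo) (suc lo) w P ℓ i k → Invariant lo lo w (P ++ [ suc lo ]) ℓ i k
  Invariant-defer {lo} {w} {P} I = record
    { perm     = subst (_↭ oneTo n) (cong (w ++_) (sym (++-assoc P [ suc lo ] (downTo lo)))) perm
    ; pending↓ = AllPairsₚ.++⁺ pending↓ ([] ∷ []) (All.map (_∷ []) pending>)
    ; pending> = Allₚ.∷ʳ⁺ (All.map (<-trans (n<1+n lo)) pending>) (n<1+n lo)
    ; written> = All.map (<-trans (n<1+n lo)) written>
    ; ascent>P = λ a b ab⊆w a<b → Allₚ.∷ʳ⁺ (ascent>P a b ab⊆w a<b) (<-trans (All.lookup written> (to∈ ab⊆w)) a<b)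
    ; avoids   = avoids
    ; lrmin≡   = lrmin≡
    ; asc≡     = asc≡
    ; length≡  = length≡
    }
    where open Invariant I

  Invariant-open : ∀ {lo w P ℓ i k} → Invariant (suc lo) (suc lo) w P ℓ i k → Jacobi w →
    Invariant lo (suc lo) (w ++ [ suc lo ]) P (suc ℓ) (suc i) k × Block emptyBlock lo (w ++ [ suc lo ]) P
  Invariant-open {lo} {w} {P} I jac = record
    { perm     = ↭-trans (subst (_↭ w ++ P ++ downTo (suc lo)) (sym (++-assoc w [ suc lo ] (P ++ downTo lo)))
                           (++⁺ˡ w (↭-sym (shift (suc lo) P (downTo lo)))))
                         perm
    ; pending↓ = pending↓
    ; pending> = pending>
    ; written> = Allₚ.∷ʳ⁺ (All.map (<-trans (n<1+n lo)) written>) (n<1+n lo)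
    ; ascent>P = ascent>P′
    ; avoids   = Avoids123-∷ʳ avoids (λ a b ab⊆w a<b → <-trans (All.lookup written> (to∈ ab⊆w)) a<b)
    ; lrmin≡   = trans (lrmin-∷ʳ-below w written>) (cong suc lrmin≡)
    ; asc≡     = trans (asc-∷ʳ-below w written>) asc≡
    ; length≡  = trans (length-∷ʳ w (suc lo)) (cong suc length≡)
    }
    , record
    { before = w ; run = [] ; shape = refl ; jacobi = jac ; before> = written>
    ; run> = [] ; run↓ = [] ; run>P = [] ; runParity = refl ; last = λ ne → ⊥-elim (ne refl)
    }
    where
    open Invariant I
    ascent>P′ : ∀ a b → (a ∷ b ∷ []) ⊆ w ++ [ suc lo ] → a < b → All (_< b) P
    ascent>P′ a b ab⊆ a<b with pair-⊆-∷ʳ⁻ w (suc lo) ab⊆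
    ... | inj₁ ab⊆w       = ascent>P a b ab⊆w a<b
    ... | inj₂ (a∈w , refl) = ⊥-elim (<-asym a<b (All.lookup written> a∈w))

  Invariant-emit : ∀ {lo w h P ℓ i k k′} → Invariant lo (suc lo) w (h ∷ P) ℓ i k → suc lo ∈ w →
    asc (w ++ [ h ]) ≡ k′ →
    Invariant lo (suc lo) (w ++ [ h ]) P (suc ℓ) i k′
  Invariant-emit {lo} {w} {h} {P} I μ∈w asc≡′ = record
    { perm     = subst (_↭ oneTo n) (sym (++-assoc w [ h ] (P ++ downTo lo))) perm
    ; pending↓ = AllPairs.tail pending↓
    ; pending> = All.tail pending>
    ; written> = Allₚ.∷ʳ⁺ written> (<-trans (n<1+n lo) (All.head pending>))
    ; ascent>P = ascent>P′
    ; avoids   = Avoids123-∷ʳ avoids (λ a b ab⊆w a<b → All.head (ascent>P a b ab⊆w a<b))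
    ; lrmin≡   = trans (lrmin-∷ʳ-above μ∈w (All.head pending>)) lrmin≡
    ; asc≡     = asc≡′
    ; length≡  = trans (length-∷ʳ w h) (cong suc length≡)
    }
    where
    open Invariant I
    ascent>P′ : ∀ a b → (a ∷ b ∷ []) ⊆ w ++ [ h ] → a < b → All (_< b) P
    ascent>P′ a b ab⊆ a<b with pair-⊆-∷ʳ⁻ w h ab⊆
    ... | inj₁ ab⊆w    = All.tail (ascent>P a b ab⊆w a<b)
    ... | inj₂ (_ , refl) = AllPairs.head pending↓

  emit-first : ∀ {lo w h P ℓ i k} → Invariant lo (suc lo) w (h ∷ P) ℓ i k → Block emptyBlock lo w (h ∷ P) →
    Invariant lo (suc lo) (w ++ [ h ]) P (suc ℓ) i (suc k) × Block oddBlock lo (w ++ [ h ]) P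
  emit-first {lo} {h = h} I record { before = before ; shape = refl ; jacobi = jac ; before> = before> ; runParity = refl } =
    Invariant-emit I (∈-++⁺ʳ before (here refl)) (trans (asc-∷ʳ-ascent before μ<h) (cong suc (Invariant.asc≡ I)))
    , record
    { before = before ; run = [ h ] ; shape = ++-assoc before [ suc lo ] [ h ] ; jacobi = jac ; before> = before>
    ; run> = μ<h ∷ [] ; run↓ = [] ∷ [] ; run>P = h>P ∷ [] ; runParity = 0 , refl
    ; last = λ _ → before ++ [ suc lo ] , h , refl , μ<h , h>P
    }
    where
    μ<h = All.head (Invariant.pending> I)
    h>P = AllPairs.head (Invariant.pending↓ I)

  parity-next : ∀ st {run} h → st ≢ emptyBlock → Parity st run → Parity (next st) (run ++ [ h ])
  parity-next emptyBlock     h ne _       = ⊥-elim (ne refl)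
  parity-next evenBlock {run} h _ (m , eq) = m , trans (length-∷ʳ run h) (cong suc eq)
  parity-next oddBlock  {run} h _ (m , eq) = suc m , trans (length-∷ʳ run h) (trans (cong suc eq) (sym (*-suc 2 m)))

  emit-next : ∀ {st lo w h P ℓ i k} → st ≢ emptyBlock →
    Invariant lo (suc lo) w (h ∷ P) ℓ i k → Block st lo w (h ∷ P) →
    Invariant lo (suc lo) (w ++ [ h ]) P (suc ℓ) i k × Block (next st) lo (w ++ [ h ]) P
  emit-next {st} {lo} {h = h} ne I
    record { before = before ; run = run ; shape = refl ; jacobi = jac ; before> = before> ; run> = run>
           ; run↓ = run↓ ; run>P = run>P ; runParity = par ; last = last }
    with last ne
  ... | w′ , b , w≡w′b , _ , b>hP =
    Invariant-emit I (∈-++⁺ʳ before (here refl))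
      (trans (cong (λ v → asc (v ++ [ h ])) w≡w′b) (trans (asc-∷ʳ-descent w′ (All.head b>hP))
        (trans (cong asc (sym w≡w′b)) (Invariant.asc≡ I))))
    , record
    { before = before ; run = run ++ [ h ] ; shape = ++-assoc before (suc lo ∷ run) [ h ] ; jacobi = jac
    ; before> = before> ; run> = Allₚ.∷ʳ⁺ run> μ<h
    ; run↓ = AllPairsₚ.++⁺ run↓ ([] ∷ []) (All.map (λ b>hP → All.head b>hP ∷ []) run>P)
    ; run>P = Allₚ.∷ʳ⁺ (All.map All.tail run>P) h>P
    ; runParity = parity-next st h ne par
    ; last = λ _ → before ++ suc lo ∷ run , h , refl , μ<h , h>P
    }
    where
    μ<h = All.head (Invariant.pending> I)
    h>P = AllPairs.head (Invariant.pending↓ I)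

  even-length : ∀ st {run} → st ≢ oddBlock → Parity st run → 2 ∣ length run
  even-length emptyBlock ne refl     = 2 ∣0
  even-length evenBlock  ne (m , eq) = divides m (trans eq (*-comm 2 m))
  even-length oddBlock   ne _        = ⊥-elim (ne refl)

  Invariant-close : ∀ {st lo w P ℓ i k} → Invariant lo (suc lo) w P ℓ i k → Block st lo w P → st ≢ oddBlock →
    Invariant lo lo w P ℓ i k × Jacobi w
  Invariant-close {st} {lo} I
    record { shape = refl ; jacobi = jac ; before> = before> ; run> = run> ; run↓ = run↓ ; runParity = par } ¬odd =
    record
    { perm = perm ; pending↓ = pending↓ ; pending> = All.map (<-trans (n<1+n lo)) pending> ; written> = written>
    ; ascent>P = ascent>P ; avoids = avoids ; lrmin≡ = lrmin≡ ; asc≡ = asc≡ ; length≡ = length≡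
    }
    , Jacobi-++-block jac before> run> run↓ (even-length st ¬odd par)
    where open Invariant I

  Invariant-length : ∀ {lo pb w P ℓ i k} → Invariant lo pb w P ℓ i k → ℓ + length P + lo ≡ n
  Invariant-length {lo} {w = w} {P} {ℓ} I = begin
    ℓ + length P + lo
      ≡⟨ cong₂ (λ a b → a + length P + b) (sym length≡) (sym (length-applyDownFrom suc lo)) ⟩
    length w + length P + length (downTo lo)      ≡⟨ +-assoc (length w) (length P) _ ⟩
    length w + (length P + length (downTo lo))    ≡⟨ cong (length w +_) (length-++ P) ⟨
    length w + length (P ++ downTo lo)            ≡⟨ length-++ w ⟨
    length (w ++ P ++ downTo lo)                  ≡⟨ ↭-length perm ⟩
    length (oneTo n)                              ≡⟨ length-oneTo n ⟩
    n                                             ∎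
    where open Invariant I

  Invariant-scanned : ∀ {u pb w P ℓ i k} → u ≤ n → Invariant (n ∸ u) pb w P ℓ i k → ℓ + length P ≡ u
  Invariant-scanned {u} u≤n I = +-cancelʳ-≡ (n ∸ u) _ _ (trans (Invariant-length I) (sym (m+[n∸m]≡n u≤n)))

  emit-sound : ∀ {st st′ u ℓ i k k′ w₀ P₀ w P} → u ≤ n → ℓ < u →
    (∀ {h P₁} → Invariant (n ∸ u) (suc (n ∸ u)) w₀ (h ∷ P₁) ℓ i k → Block st (n ∸ u) w₀ (h ∷ P₁) →
       Invariant (n ∸ u) (suc (n ∸ u)) (w₀ ++ [ h ]) P₁ (suc ℓ) i k′ × Block st′ (n ∸ u) (w₀ ++ [ h ]) P₁) →
    Invariant (n ∸ u) (suc (n ∸ u)) w₀ P₀ ℓ i k × Block st (n ∸ u) w₀ P₀ → (w , P) ≡ emit (w₀ , P₀) →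
    Invariant (n ∸ u) (suc (n ∸ u)) w P (suc ℓ) i k′ × Block st′ (n ∸ u) w P
  emit-sound {ℓ = ℓ} {P₀ = []} u≤n ℓ<u _ (I , _) _ =
    ⊥-elim (<-irrefl (trans (sym (+-identityʳ ℓ)) (Invariant-scanned u≤n I)) ℓ<u)
  emit-sound {P₀ = h ∷ P₁} u≤n ℓ<u step (I , B) refl = step I B

  ∈-emitted⁻ : ∀ {ℓ u x L} → x ∈ (if ℓ <ᵇ u then map emit L else []) → ℓ < u × ∃ λ s → s ∈ L × x ≡ emit s
  ∈-emitted⁻ {zero}  {suc u} x∈ = z<s , ∈-map⁻ emit x∈
  ∈-emitted⁻ {suc ℓ} {suc u} x∈ with ∈-emitted⁻ {ℓ} {u} x∈
  ... | ℓ<u , found = s<s ℓ<u , found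

  start-sound : ∀ u ℓ i k {w P} → (w , P) ∈ start u ℓ i k → Invariant (n ∸ u) (n ∸ u) w P ℓ i k × Jacobi w
  start-sound zero zero zero zero (here refl) = record
    { perm = downTo↭oneTo n ; pending↓ = [] ; pending> = [] ; written> = []
    ; ascent>P = λ _ _ () ; avoids = λ _ _ _ () ; lrmin≡ = refl ; asc≡ = refl ; length≡ = refl
    }
    , tt

  mutual
    closed-sound : ∀ u ℓ i k {w P} → u ≤ n → (w , P) ∈ closed u ℓ i k →
      Invariant (n ∸ u) (n ∸ u) w P ℓ i k × Jacobi w
    closed-sound u ℓ i k u≤n x∈ with ∈-++⁻ (start u ℓ i k) x∈
    ... | inj₁ s∈start = start-sound u ℓ i k s∈start
    ... | inj₂ s∈open with ∈-++⁻ (opened u ℓ i k) s∈open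
    ...   | inj₁ s∈opened   = let I , B = opened-sound u ℓ i k u≤n s∈opened in Invariant-close I B (λ ())
    ...   | inj₂ s∈evenOpen = let I , B = evenOpen-sound u ℓ i k u≤n s∈evenOpen in Invariant-close I B (λ ())

    ready-sound : ∀ u ℓ i k {w P} → u ≤ n → (w , P) ∈ ready u ℓ i k →
      Invariant (suc n ∸ u) (suc n ∸ u) w P ℓ i k × Jacobi w
    ready-sound (suc u) ℓ i k u<n x∈ with ∈-++⁻ (closed u ℓ i k) x∈
    ... | inj₁ s∈closed   = closed-sound u ℓ i k (<⇒≤ u<n) s∈closed
    ... | inj₂ s∈deferred with ∈-map⁻ (defer (suc n ∸ u)) s∈deferred
    ...   | _ , s∈ready , refl with ready-sound u ℓ i k (<⇒≤ u<n) s∈ready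
    ...     | I , jac rewrite +-∸-assoc 1 (<⇒≤ u<n) = Invariant-defer I , jac

    opened-sound : ∀ u ℓ i k {w P} → u ≤ n → (w , P) ∈ opened u ℓ i k →
      Invariant (n ∸ u) (suc (n ∸ u)) w P ℓ i k × Block emptyBlock (n ∸ u) w P
    opened-sound u (suc ℓ) (suc i) k u≤n x∈ with ∈-map⁻ (write (suc n ∸ u)) x∈
    ... | _ , s∈ready , refl with ready-sound u ℓ i k u≤n s∈ready
    ...   | I , jac rewrite +-∸-assoc 1 u≤n = Invariant-open I jac

    oddOpen-sound : ∀ u ℓ i k {w P} → u ≤ n → (w , P) ∈ oddOpen u ℓ i k →
      Invariant (n ∸ u) (suc (n ∸ u)) w P ℓ i k × Block oddBlock (n ∸ u) w P
    oddOpen-sound u (suc ℓ) i zero u≤n x∈ with ∈-emitted⁻ {ℓ} {u} x∈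
    ... | ℓ<u , _ , s∈evenOpen , eq =
      emit-sound u≤n ℓ<u (emit-next (λ ())) (evenOpen-sound u ℓ i zero u≤n s∈evenOpen) eq
    oddOpen-sound u (suc ℓ) i (suc k) u≤n x∈ with ∈-emitted⁻ {ℓ} {u} x∈
    ... | ℓ<u , _ , s∈block , eq with ∈-++⁻ (opened u ℓ i k) s∈block
    ...   | inj₁ s∈opened   = emit-sound u≤n ℓ<u emit-first (opened-sound u ℓ i k u≤n s∈opened) eq
    ...   | inj₂ s∈evenOpen = emit-sound u≤n ℓ<u (emit-next (λ ())) (evenOpen-sound u ℓ i (suc k) u≤n s∈evenOpen) eq

    evenOpen-sound : ∀ u ℓ i k {w P} → u ≤ n → (w , P) ∈ evenOpen u ℓ i k →
      Invariant (n ∸ u) (suc (n ∸ u)) w P ℓ i k × Block evenBlock (n ∸ u) w P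
    evenOpen-sound u (suc ℓ) i k u≤n x∈ with ∈-emitted⁻ {ℓ} {u} x∈
    ... | ℓ<u , _ , s∈oddOpen , eq = emit-sound u≤n ℓ<u (emit-next (λ ())) (oddOpen-sound u ℓ i k u≤n s∈oddOpen) eq

  DistinctWords : List State → Set
  DistinctWords = AllPairs (λ s t → proj₁ s ≢ proj₁ t)

  DistinctWords-map : ∀ f {L} → (∀ {s t} → proj₁ (f s) ≡ proj₁ (f t) → proj₁ s ≡ proj₁ t) →
    DistinctWords L → DistinctWords (map f L)
  DistinctWords-map f f-inj d = AllPairsₚ.map⁺ (AllPairs.map (λ s≢t fs≡ft → s≢t (f-inj fs≡ft)) d)

  DistinctWords-++ : ∀ {L M} → DistinctWords L → DistinctWords M →
    (∀ {s t} → s ∈ L → t ∈ M → proj₁ s ≢ proj₁ t) → DistinctWords (L ++ M)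
  DistinctWords-++ dL dM L#M = AllPairsₚ.++⁺ dL dM (All.tabulate λ s∈L → All.tabulate λ t∈M → L#M s∈L t∈M)

  DistinctWords-if : ∀ b {L} → DistinctWords L → DistinctWords (if b then L else [])
  DistinctWords-if true  d = d
  DistinctWords-if false d = []

  write-injective : ∀ v s t → proj₁ (write v s) ≡ proj₁ (write v t) → proj₁ s ≡ proj₁ t
  write-injective v (w , _) (w′ , _) = ∷ʳ-injectiveˡ w w′

  emit-injective : ∀ s t → proj₁ (emit s) ≡ proj₁ (emit t) → proj₁ s ≡ proj₁ t
  emit-injective (w , [])    (w′ , [])    = ∷ʳ-injectiveˡ w w′
  emit-injective (w , [])    (w′ , _ ∷ _) = ∷ʳ-injectiveˡ w w′
  emit-injective (w , _ ∷ _) (w′ , [])    = ∷ʳ-injectiveˡ w w′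
  emit-injective (w , _ ∷ _) (w′ , _ ∷ _) = ∷ʳ-injectiveˡ w w′

  start-member : ∀ u ℓ i k {w P} → (w , P) ∈ start u ℓ i k → w ≡ [] × P ≡ [] × u ≡ 0
  start-member zero zero zero zero (here refl) = refl , refl , refl

  Block-∈ : ∀ {st lo w P} → Block st lo w P → suc lo ∈ w
  Block-∈ record { before = before ; shape = refl } = ∈-++⁺ʳ before (here refl)

  empty#nonempty : ∀ {st lo w P P′} → st ≢ emptyBlock → Block emptyBlock lo w P → Block st lo w P′ → ⊥
  empty#nonempty ne record { before = before ; shape = refl ; runParity = refl } B with Block.last B ne
  ... | w′ , b , eq , μ<b , _ = <-irrefl (∷ʳ-injectiveʳ before w′ eq) μ<b

  closed-∋μ : ∀ u ℓ i k {w P} → u ≤ n → (w , P) ∈ closed u ℓ i k → u ≡ 0 ⊎ suc (n ∸ u) ∈ w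
  closed-∋μ u ℓ i k u≤n x∈ with ∈-++⁻ (start u ℓ i k) x∈
  ... | inj₁ s∈start = inj₁ (proj₂ (proj₂ (start-member u ℓ i k s∈start)))
  ... | inj₂ s∈open with ∈-++⁻ (opened u ℓ i k) s∈open
  ...   | inj₁ s∈opened   = inj₂ (Block-∈ (proj₂ (opened-sound u ℓ i k u≤n s∈opened)))
  ...   | inj₂ s∈evenOpen = inj₂ (Block-∈ (proj₂ (evenOpen-sound u ℓ i k u≤n s∈evenOpen)))

  mutual
    closed-distinct : ∀ u ℓ i k → u ≤ n → DistinctWords (closed u ℓ i k)
    closed-distinct u ℓ i k u≤n =
      DistinctWords-++ (start-distinct u ℓ i k)
        (DistinctWords-++ (opened-distinct u ℓ i k u≤n) (evenOpen-distinct u ℓ i k u≤n) opened#evenOpen)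
        start#open
      where
      start-distinct : ∀ u ℓ i k → DistinctWords (start u ℓ i k)
      start-distinct zero    zero    zero    zero    = [] ∷ []
      start-distinct zero    zero    zero    (suc k) = []
      start-distinct zero    zero    (suc i) k       = []
      start-distinct zero    (suc ℓ) i       k       = []
      start-distinct (suc u) ℓ       i       k       = []
      opened#evenOpen : ∀ {s t} → s ∈ opened u ℓ i k → t ∈ evenOpen u ℓ i k → proj₁ s ≢ proj₁ t
      opened#evenOpen {_ , _} {_ , _} s∈ t∈ refl =
        empty#nonempty (λ ()) (proj₂ (opened-sound u ℓ i k u≤n s∈)) (proj₂ (evenOpen-sound u ℓ i k u≤n t∈))
      start#open : ∀ {s t} → s ∈ start u ℓ i k → t ∈ opened u ℓ i k ++ evenOpen u ℓ i k → proj₁ s ≢ proj₁ t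
      start#open {_ , _} {_ , _} s∈ t∈ refl with start-member u ℓ i k s∈ | ∈-++⁻ (opened u ℓ i k) t∈
      ... | refl , _ | inj₁ t∈opened   with () ← Block-∈ (proj₂ (opened-sound u ℓ i k u≤n t∈opened))
      ... | refl , _ | inj₂ t∈evenOpen with () ← Block-∈ (proj₂ (evenOpen-sound u ℓ i k u≤n t∈evenOpen))

    ready-distinct : ∀ u ℓ i k → u ≤ n → DistinctWords (ready u ℓ i k)
    ready-distinct zero    ℓ i k _   = []
    ready-distinct (suc u) ℓ i k u<n =
      DistinctWords-++ (closed-distinct u ℓ i k (<⇒≤ u<n))
        (DistinctWords-map (defer (suc n ∸ u)) (λ eq → eq) (ready-distinct u ℓ i k (<⇒≤ u<n)))
        closed#deferred
      where
      closed#deferred : ∀ {s t} → s ∈ closed u ℓ i k → t ∈ map (defer (suc n ∸ u)) (ready u ℓ i k) →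
        proj₁ s ≢ proj₁ t
      closed#deferred {_ , _} {_ , _} s∈ t∈ refl with ∈-map⁻ (defer (suc n ∸ u)) t∈
      ... | _ , t∈ready , refl with closed-∋μ u ℓ i k (<⇒≤ u<n) s∈
      ...   | inj₁ refl = case t∈ready of λ ()
      ...   | inj₂ μ∈w = <-irrefl (+-∸-assoc 1 (<⇒≤ u<n))
                             (All.lookup (Invariant.written> (proj₁ (ready-sound u ℓ i k (<⇒≤ u<n) t∈ready))) μ∈w)

    opened-distinct : ∀ u ℓ i k → u ≤ n → DistinctWords (opened u ℓ i k)
    opened-distinct u zero    i       k _   = []
    opened-distinct u (suc ℓ) zero    k _   = []
    opened-distinct u (suc ℓ) (suc i) k u≤n =
      DistinctWords-map (write (suc n ∸ u)) (λ {s} {t} → write-injective (suc n ∸ u) s t) (ready-distinct u ℓ i k u≤n)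

    oddOpen-distinct : ∀ u ℓ i k → u ≤ n → DistinctWords (oddOpen u ℓ i k)
    oddOpen-distinct u zero    i k       _   = []
    oddOpen-distinct u (suc ℓ) i zero    u≤n =
      DistinctWords-if (ℓ <ᵇ u) (DistinctWords-map emit (λ {s} {t} → emit-injective s t) (evenOpen-distinct u ℓ i zero u≤n))
    oddOpen-distinct u (suc ℓ) i (suc k) u≤n =
      DistinctWords-if (ℓ <ᵇ u) (DistinctWords-map emit (λ {s} {t} → emit-injective s t)
        (DistinctWords-++ (opened-distinct u ℓ i k u≤n) (evenOpen-distinct u ℓ i (suc k) u≤n) opened#evenOpen))
      where
      opened#evenOpen : ∀ {s t} → s ∈ opened u ℓ i k → t ∈ evenOpen u ℓ i (suc k) → proj₁ s ≢ proj₁ t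
      opened#evenOpen {_ , _} {_ , _} s∈ t∈ refl =
        empty#nonempty (λ ()) (proj₂ (opened-sound u ℓ i k u≤n s∈)) (proj₂ (evenOpen-sound u ℓ i (suc k) u≤n t∈))

    evenOpen-distinct : ∀ u ℓ i k → u ≤ n → DistinctWords (evenOpen u ℓ i k)
    evenOpen-distinct u zero    i k _   = []
    evenOpen-distinct u (suc ℓ) i k u≤n =
      DistinctWords-if (ℓ <ᵇ u) (DistinctWords-map emit (λ {s} {t} → emit-injective s t) (oddOpen-distinct u ℓ i k u≤n))

  ∈-if⁺ : ∀ {A : Set} {ℓ u} {x : A} {xs} → ℓ < u → x ∈ xs → x ∈ (if ℓ <ᵇ u then xs else [])
  ∈-if⁺ {x = x} ℓ<u x∈xs = subst (x ∈_) (sym (if-<ᵇ-true ℓ<u)) x∈xs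

  pending⇒ℓ<u : ∀ {u pb w h P ℓ i k} → u ≤ n → Invariant (n ∸ u) pb w (h ∷ P) ℓ i k → ℓ < u
  pending⇒ℓ<u {ℓ = ℓ} u≤n I = subst (ℓ <_) (Invariant-scanned u≤n I) (m<m+n ℓ z<s)

  opened-emit : ∀ {u ℓ i k w h P} → ℓ < u → (w , h ∷ P) ∈ opened u ℓ i k →
    (w ++ [ h ] , P) ∈ oddOpen u (suc ℓ) i (suc k)
  opened-emit ℓ<u x∈ = ∈-if⁺ ℓ<u (∈-map⁺ emit (∈-++⁺ˡ x∈))

  evenOpen-emit : ∀ {u ℓ i} k {w h P} → ℓ < u → (w , h ∷ P) ∈ evenOpen u ℓ i k →
    (w ++ [ h ] , P) ∈ oddOpen u (suc ℓ) i k
  evenOpen-emit             zero    ℓ<u x∈ = ∈-if⁺ ℓ<u (∈-map⁺ emit x∈)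
  evenOpen-emit {u} {ℓ} {i} (suc k) ℓ<u x∈ = ∈-if⁺ ℓ<u (∈-map⁺ emit (∈-++⁺ʳ (opened u ℓ i k) x∈))

  oddOpen-emit : ∀ {u ℓ i k w h P} → ℓ < u → (w , h ∷ P) ∈ oddOpen u ℓ i k →
    (w ++ [ h ] , P) ∈ closed u (suc ℓ) i k
  oddOpen-emit {u} {ℓ} {i} {k} ℓ<u x∈ =
    ∈-++⁺ʳ (start u (suc ℓ) i k) (∈-++⁺ʳ (opened u (suc ℓ) i k) (∈-if⁺ ℓ<u (∈-map⁺ emit x∈)))

  ready-skip : ∀ d {u ℓ i k w Q} → (w , Q) ∈ ready u ℓ i k → ∃ λ Q′ → (w , Q′) ∈ ready (d + u) ℓ i k
  ready-skip zero    x∈ = _ , x∈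
  ready-skip (suc d) {u} {ℓ} {i} {k} x∈ with ready-skip d x∈
  ... | Q′ , x∈′ =
    Q′ ++ [ suc n ∸ (d + u) ] , ∈-++⁺ʳ (closed (d + u) ℓ i k) (∈-map⁺ (defer (suc n ∸ (d + u))) x∈′)

  record Reachable (w : List ℕ) : Set where
    constructor reached
    field
      u ℓ i k : ℕ
      P       : List ℕ
      u≤n     : u ≤ n
      member  : (w , P) ∈ closed u ℓ i k ⊎ (w , P) ∈ oddOpen u ℓ i k

  -- Deferring the d values above x puts x next in line, to be written as a new left-to-right
  -- minimum.
  write-after-skip : ∀ {u ℓ i k w x′} → u ≤ n → suc x′ ≤ n ∸ u →
    (∃ λ Q → (w , Q) ∈ ready (n ∸ u ∸ suc x′ + suc u) ℓ i k) → Reachable (w ++ [ suc x′ ])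
  write-after-skip {u} {ℓ} {i} {k} {w} {x′} u≤n x<lo (Q , s∈ready) =
    reached u′ (suc ℓ) (suc i) k Q u′≤n
      (inj₁ (∈-++⁺ʳ (start u′ (suc ℓ) (suc i) k) (∈-++⁺ˡ
        (subst (λ v → (w ++ [ v ] , Q) ∈ opened u′ (suc ℓ) (suc i) k) v≡x (∈-map⁺ (write (suc n ∸ u′)) s∈ready)))))
    where
    d  = n ∸ u ∸ suc x′
    u′ = d + suc u
    n≡ : u + (suc x′ + d) ≡ n
    n≡ = trans (cong (u +_) (m+[n∸m]≡n x<lo)) (m+[n∸m]≡n u≤n)
    regroup₁ : ∀ u x′ d → suc (u + (suc x′ + d)) ≡ suc x′ + (d + suc u)
    regroup₁ = solve-∀
    regroup₂ : ∀ u x′ d → d + suc u + x′ ≡ u + (suc x′ + d)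
    regroup₂ = solve-∀
    v≡x : suc n ∸ u′ ≡ suc x′
    v≡x = trans (cong (λ m → suc m ∸ u′) (sym n≡))
                (trans (cong (_∸ u′) (regroup₁ u x′ d)) (m+n∸n≡m (suc x′) u′))
    u′≤n : u′ ≤ n
    u′≤n = subst (u′ ≤_) (trans (regroup₂ u x′ d) n≡) (m≤m+n u′ x′)

  module Completeness (π : List ℕ) (π-perm : IsPerm n π) (π-avoids : Avoids123 π) (π-jacobi : Jacobi π) where

    π-unique : Unique π
    π-unique = Unique-↭ (↭-sym π-perm) (Unique-oneTo n)

    letter-location : ∀ {lo pb w P ℓ i k x vs} → Invariant lo pb w P ℓ i k → π ≡ w ++ x ∷ vs →
      x ∈ P ⊎ x ∈ downTo lo
    letter-location {w = w} {P} {x = x} {vs} I π≡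
      with ∈-++⁻ w (∈-resp-↭ (↭-sym (Invariant.perm I)) (∈-resp-↭ π-perm x∈π))
      where x∈π = subst (x ∈_) (sym π≡) (∈-++⁺ʳ w (here refl))
    ... | inj₁ x∈w  = ⊥-elim (Unique-++⇒disjoint w (subst Unique π≡ π-unique) x∈w (here refl))
    ... | inj₂ x∈Pd = ∈-++⁻ P x∈Pd

    odd-run⇒⊥ : ∀ {lo w P vs} → Block oddBlock lo w P → π ≡ w ++ vs → rhoLen (suc lo) vs ≡ 0 → ⊥
    odd-run⇒⊥ {lo} {vs = vs}
      record { before = before ; run = run ; shape = refl ; run> = run> ; runParity = m , |run|≡odd } π≡ ρ≡0 =
      odd∤ m (subst (2 ∣_) |run|≡odd
        (Jacobi⇒even-run before vs (subst Jacobi (trans π≡ (++-assoc before (suc lo ∷ run) vs)) π-jacobi) run> ρ≡0))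

    new-lrmin : ∀ {u ℓ i k w P x vs} → u ≤ n → (w , P) ∈ closed u ℓ i k → π ≡ w ++ x ∷ vs → x ∈ downTo (n ∸ u) →
      Reachable (w ++ [ x ])
    new-lrmin {u} {ℓ} {i} {k} u≤n s∈closed _ x∈downTo with ∈downTo⁻ (n ∸ u) x∈downTo
    ... | x′ , refl , x′<lo =
      write-after-skip u≤n x′<lo
        (ready-skip (n ∸ u ∸ suc x′) (∈-++⁺ˡ {ys = map (defer (suc n ∸ u)) (ready u ℓ i k)} s∈closed))

    -- Otherwise the last left-to-right minimum, x and the head of P would form a 123 pattern.
    pending-head : ∀ {st lo w P ℓ i k x vs} → Invariant lo (suc lo) w P ℓ i k → Block st lo w P →
      π ≡ w ++ x ∷ vs → x ∈ P →
      ∃ λ P′ → P ≡ x ∷ P′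
    pending-head {P = h ∷ P′} I B π≡ (here refl) = P′ , refl
    pending-head {lo = lo} {w} {h ∷ P′} {x = x} {vs} I B π≡ (there x∈P′) =
      ⊥-elim (π-avoids (suc lo) x h μxh⊆π (μ<x , x<h))
      where
      μ<x = All.lookup (Invariant.pending> I) (there x∈P′)
      x<h = All.lookup (AllPairs.head (Invariant.pending↓ I)) x∈P′
      h∈vs : h ∈ vs
      h∈vs with ∈-++⁻ w (subst (h ∈_) π≡ (∈-resp-↭ (↭-sym π-perm) (∈-resp-↭ (Invariant.perm I) (∈-++⁺ʳ w (here refl)))))
      ... | inj₁ h∈w =
        ⊥-elim (Unique-++⇒disjoint w (Unique-↭ (↭-sym (Invariant.perm I)) (Unique-oneTo n)) h∈w (here refl))
      ... | inj₂ (here h≡x) = ⊥-elim (<-irrefl (sym h≡x) x<h)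
      ... | inj₂ (there h∈vs) = h∈vs
      μxh⊆π : (suc lo ∷ x ∷ h ∷ []) ⊆ π
      μxh⊆π = subst ((suc lo ∷ x ∷ h ∷ []) ⊆_) (sym π≡) (⊆-++⁺ (from∈ (Block-∈ B)) (refl ∷ from∈ h∈vs))

    reach-step : ∀ w x vs → π ≡ w ++ x ∷ vs → Reachable w → Reachable (w ++ [ x ])
    reach-step w x vs π≡ (reached u ℓ i k P u≤n (inj₁ s∈closed))
      with letter-location (proj₁ (closed-sound u ℓ i k u≤n s∈closed)) π≡
    ... | inj₂ x∈downTo = new-lrmin u≤n s∈closed π≡ x∈downTo
    ... | inj₁ x∈P with ∈-++⁻ (start u ℓ i k) s∈closed
    ...   | inj₁ s∈start with () ← subst (x ∈_) (proj₁ (proj₂ (start-member u ℓ i k s∈start))) x∈P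
    ...   | inj₂ s∈open with ∈-++⁻ (opened u ℓ i k) s∈open
    ...     | inj₁ s∈opened with opened-sound u ℓ i k u≤n s∈opened
    ...       | I , B with pending-head I B π≡ x∈P
    ...         | P′ , refl =
      reached u (suc ℓ) i (suc k) P′ u≤n (inj₂ (opened-emit (pending⇒ℓ<u u≤n I) s∈opened))
    reach-step w x vs π≡ (reached u ℓ i k P u≤n (inj₁ s∈closed)) | inj₁ x∈P | inj₂ s∈open | inj₂ s∈evenOpen
      with evenOpen-sound u ℓ i k u≤n s∈evenOpen
    ...       | I , B with pending-head I B π≡ x∈P
    ...         | P′ , refl =
      reached u (suc ℓ) i k P′ u≤n (inj₂ (evenOpen-emit k (pending⇒ℓ<u u≤n I) s∈evenOpen))
    reach-step w x vs π≡ (reached u ℓ i k P u≤n (inj₂ s∈oddOpen)) with oddOpen-sound u ℓ i k u≤n s∈oddOpen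
    ... | I , B with letter-location I π≡
    ...   | inj₂ x∈downTo = ⊥-elim (odd-run⇒⊥ B π≡ (rhoLen-++-≤ [] vs (m≤n⇒m≤1+n x≤lo)))
      where x≤lo = let _ , x≡ , x′<lo = ∈downTo⁻ (n ∸ u) x∈downTo in subst (_≤ n ∸ u) (sym x≡) x′<lo
    ...   | inj₁ x∈P with pending-head I B π≡ x∈P
    ...     | P′ , refl = reached u (suc ℓ) i k P′ u≤n (inj₁ (oddOpen-emit (pending⇒ℓ<u u≤n I) s∈oddOpen))

    reach : ∀ w vs → π ≡ w ++ vs → Reachable w → Reachable π
    reach w []       π≡ r = subst Reachable (sym (trans π≡ (++-identityʳ w))) r
    reach w (x ∷ vs) π≡ r = reach (w ++ [ x ]) vs (trans π≡ (sym (++-assoc w [ x ] vs))) (reach-step w x vs π≡ r)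

    π-reachable : Reachable π
    π-reachable = reach [] π refl (reached 0 0 0 0 [] z≤n (inj₁ (here refl)))

  full-word : ∀ {u pb w P ℓ i k} → u ≤ n → Invariant (n ∸ u) pb w P ℓ i k → ℓ ≡ n → u ≡ n × P ≡ []
  full-word {P = []}    u≤n I refl = sym (trans (sym (+-identityʳ n)) (Invariant-scanned u≤n I)) , refl
  full-word {P = _ ∷ _} u≤n I refl = ⊥-elim (<⇒≱ (subst (n <_) (Invariant-scanned u≤n I) (m<m+n n z<s)) u≤n)

  J-sound : ∀ {i k π} → π ∈ map proj₁ (closed n n i k) → J n i k π
  J-sound {i} {k} π∈ with ∈-map⁻ proj₁ π∈
  ... | (π , P) , x∈ , refl with closed-sound n n i k ≤-refl x∈
  ...   | I , jac with full-word ≤-refl I refl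
  ...     | _ , refl = subst (_↭ oneTo n) π++downTo0≡π perm , avoids , jac , lrmin≡ , asc≡
    where
    open Invariant I
    π++downTo0≡π : π ++ [] ++ downTo (n ∸ n) ≡ π
    π++downTo0≡π = trans (cong (λ m → π ++ downTo m) (n∸n≡0 n)) (++-identityʳ π)

  J-complete : ∀ {i k π} → J n i k π → π ∈ map proj₁ (closed n n i k)
  J-complete {i} {k} {π} (perm , avoids , jac , refl , refl) with Completeness.π-reachable π perm avoids jac
  ... | reached u ℓ i′ k′ P u≤n (inj₂ s∈oddOpen) =
    ⊥-elim (Completeness.odd-run⇒⊥ π perm avoids jac (proj₂ (oddOpen-sound u ℓ i′ k′ u≤n s∈oddOpen))
                                   (sym (++-identityʳ π)) refl)
  ... | reached u ℓ i′ k′ P u≤n (inj₁ s∈closed) with closed-sound u ℓ i′ k′ u≤n s∈closed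
  ...   | I , _ with trans (sym (Invariant.length≡ I)) (trans (↭-length perm) (length-oneTo n))
  ...     | refl with full-word u≤n I refl
  ...       | refl , refl with Invariant.lrmin≡ I | Invariant.asc≡ I
  ...         | refl | refl = ∈-map⁺ proj₁ s∈closed

  J-count : ∀ i k → HasCount (J n i k) (#closed n n i k)
  J-count i k =
    map proj₁ (closed n n i k) ,
    AllPairsₚ.map⁺ (closed-distinct n n i k ≤-refl) ,
    (λ π → J-sound , J-complete) ,
    trans (length-map proj₁ (closed n n i k)) (length-closed n n i k)

#closed-even : ∀ {n i k} m → k ≤ i → i ≤ n → n ∸ i ≡ m * 2 →
  #closed n n i k ≡ ((suc n C k) * ((suc n ∸ k) C (i ∸ k)) * binomℤ (pred' ((n ∸ i) / 2)) (pred' k)) / suc n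
#closed-even {n} {i} {k} m k≤i i≤n t≡ = sym (begin
  ((suc n C k) * ((suc n ∸ k) C (i ∸ k)) * binomℤ (pred' ((n ∸ i) / 2)) (pred' k)) / suc n
    ≡⟨ cong (λ h → ((suc n C k) * ((suc n ∸ k) C (i ∸ k)) * binomℤ (pred' h) (pred' k)) / suc n)
            (trans (cong (_/ 2) t≡) (m*n/n≡m m 2)) ⟩
  ((suc n C k) * ((suc n ∸ k) C (i ∸ k)) * binomℤ (pred' m) (pred' k)) / suc n
    ≡⟨ cong₂ (λ x y → (x * y) / suc n) (nCk*[n∸k]C[i∸k]≡nCi*iCk k≤i (m≤n⇒m≤1+n i≤n))
             (trans (binomℤ-pred′≡evenCompositions m k) (cong (λ t → evenCompositions t k) (sym t≡))) ⟩
  ((suc n C i) * (i C k) * evenCompositions (n ∸ i) k) / suc n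
    ≡⟨ cong (_/ suc n) (trans (sym (#closed-formula i≤n)) (*-comm (suc n) (#closed n n i k))) ⟩
  (#closed n n i k * suc n) / suc n
    ≡⟨ m*n/n≡m (#closed n n i k) (suc n) ⟩
  #closed n n i k ∎)

#closed-odd : ∀ {n i k} m → i ≤ n → n ∸ i ≡ suc (m * 2) → #closed n n i k ≡ 0
#closed-odd {n} {i} {k} m i≤n t≡ = *-cancelˡ-≡ _ _ (suc n) (begin
  suc n * #closed n n i k                               ≡⟨ #closed-formula i≤n ⟩
  (suc n C i) * (i C k) * evenCompositions (n ∸ i) k    ≡⟨ cong (λ t → (suc n C i) * (i C k) * evenCompositions t k) t≡ ⟩
  (suc n C i) * (i C k) * evenCompositions (suc (m * 2)) k ≡⟨ cong ((suc n C i) * (i C k) *_) (evenCompositions-odd m k) ⟩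
  (suc n C i) * (i C k) * 0                             ≡⟨ *-zeroʳ ((suc n C i) * (i C k)) ⟩
  0                                                     ≡⟨ *-zeroʳ (suc n) ⟨
  suc n * 0                                             ∎)

theorem6p4 : (n i k : ℕ) → i ≤ n → k ≤ i → 2 * k ≤ n ∸ i →
    (n % 2 ≡ i % 2 →
      HasCount (J n i k)
        (((suc n C k) * ((suc n ∸ k) C (i ∸ k))
           * binomℤ (pred' ((n ∸ i) / 2)) (pred' k)) / suc n))
    × (¬ (n % 2 ≡ i % 2) → HasCount (J n i k) 0)
theorem6p4 n i k i≤n k≤i _ with n∸i-parity i≤n
... | inj₁ (m , t≡ , same) =
  (λ _ → subst (HasCount (J n i k)) (#closed-even m k≤i i≤n t≡) (Scan.J-count n i k)) ,
  (λ differ → ⊥-elim (differ same))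
... | inj₂ (m , t≡ , differ) =
  (λ same → ⊥-elim (differ same)) ,
  (λ _ → subst (HasCount (J n i k)) (#closed-odd m i≤n t≡) (Scan.J-count n i k))
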